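{- For every positive integer $k$, as formal power series in $q$, \[ \sum_{n=1}^{\infty}\overline{\mathrm{spt}}k'(n)\,q^n=\frac{(q;q)_{k-1}}{(-q;q)_{k}}-\frac{(q;q)_{\infty}}{(-q;q)_{\infty}}. \]
   Context: Notation: $(a;q)_N=\prod_{j=0}^{N-1}(1-aq^j)$ (with $(a;q)_0=1$) and $(a;q)_\infty=\prod_{j\ge 0}(1-aq^j)$. An overpartition of $n$ is a partition of $n$ in which the first occurrence of each distinct part size may be overlined. For an overpartition $\pi$, $s(\pi)$ denotes its smallest non-overlined part. For a positive integer $k$, let $\overline{\mathrm{Spt}}k(n)$ be the set of overpartitions $\pi$ of $n$ having at least one non-overlined part, whose smallest non-overlined part $s(\pi)$ appears exactly $k$ times, and in which every overlined part is strictly bigger than $s(\pi)$. Let $a_e(k,n)$ (resp. $a_o(k,n)$) be the number of $\pi\in\overline{\mathrm{Spt}}k(n)$ for which the number of parts (counted with multiplicity, overlined or not) greater than $s(\pi)$ is even (resp. odd), and $\overline{\mathrm{spt}}k'(n)=a_e(k,n)-a_o(k,n)$. (Equivalently, $\sum_{n\ge1}\overline{\mathrm{spt}}k'(n)q^n=\sum_{n\ge1}q^{kn}\frac{(q^{n+1};q)_\infty}{(-q^{n+1};q)_\infty}$.) -}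

module Defs where

open import Data.Nat as ℕ using (ℕ; zero; suc; _∸_; _≡ᵇ_; _<ᵇ_)
open import Data.Integer as ℤ using (ℤ; +_; -_)
open import Data.Bool using (Bool; true; false; if_then_else_; _∧_; not)
open import Data.List using (List; []; _∷_; _++_; concatMap; filter; length; upTo; map)
open import Data.Maybe using (Maybe; just; nothing)
open import Data.Product using (_×_; _,_; proj₁; proj₂)
open import Relation.Nullary.Decidable using (does)
open import Relation.Binary.PropositionalEquality using (_≡_)

PS : Set
PS = ℕ → ℤ

sumTo : ℕ → (ℕ → ℤ) → ℤ
sumTo zero    f = f 0
sumTo (suc n) f = sumTo n f ℤ.+ f (suc n)

_⊕_ : PS → PS → PS
(f ⊕ g) n = f n ℤ.+ g n

_⊖_ : PS → PS → PS
(f ⊖ g) n = f n ℤ.- g n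

neg : PS → PS
neg f n = - f n

_⊛_ : PS → PS → PS
(f ⊛ g) n = sumTo n (λ i → f i ℤ.* g (n ∸ i))

qpow : ℕ → PS
qpow m n = if m ≡ᵇ n then + 1 else + 0

one : PS
one = qpow 0

-- Multiplicative inverse of a series f with f 0 = 1:
-- g 0 = 1,  g n = - Σ_{i=1}^{n} f i * g (n - i).
-- invRev f n = [g n, g (n-1), ..., g 0].
private
  acc : PS → ℕ → List ℤ → ℤ
  acc f i []       = + 0
  acc f i (g ∷ gs) = f i ℤ.* g ℤ.+ acc f (suc i) gs

  hd : List ℤ → ℤ
  hd []      = + 0
  hd (x ∷ _) = x

invRev : PS → ℕ → List ℤ
invRev f zero    = + 1 ∷ []
invRev f (suc n) = (- acc f 1 (invRev f n)) ∷ invRev f n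

inv : PS → PS
inv f n = hd (invRev f n)

_⊘_ : PS → PS → PS
f ⊘ g = f ⊛ inv g

prodTo : ℕ → (ℕ → PS) → PS
prodTo zero    F = one
prodTo (suc N) F = prodTo N F ⊛ F N

poch : PS → ℕ → PS
poch a N = prodTo N (λ j → one ⊖ (a ⊛ qpow j))

-- (a;q)_∞ for a series a with zero constant term (here a = ±q):
-- the coefficient of q^n is that of the finite product (a;q)_{n+1},
-- since the remaining factors are ≡ 1 mod q^{n+1}.
pochInf : PS → PS
pochInf a n = poch a (suc n) n

-- Overpartitions.
-- An overpartition is a list of entries (s , c , b) with strictly
-- decreasing part sizes s ≥ 1, multiplicity c ≥ 1, and b = true iff the
-- first occurrence of s is overlined.

Entry : Set
Entry = ℕ × ℕ × Bool

size : Entry → ℕ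
size (s , _ , _) = s

mult : Entry → ℕ
mult (_ , c , _) = c

over : Entry → Bool
over (_ , _ , b) = b

nonOver : Entry → ℕ
nonOver (_ , c , b) = if b then c ∸ 1 else c

OverPartition : Set
OverPartition = List Entry

opsBounded : ℕ → ℕ → List OverPartition
opsBounded zero zero    = [] ∷ []
opsBounded zero (suc _) = []
opsBounded (suc m) n =
  opsBounded m n ++
  concatMap (λ c → concatMap (λ b →
       map ((suc m , c , b) ∷_) (opsBounded m (n ∸ c ℕ.* suc m)))
     (false ∷ true ∷ []))
    (filter (λ c → c ℕ.* suc m ℕ.≤? n) (map suc (upTo n)))

overpartitions : ℕ → List OverPartition
overpartitions n = opsBounded n n

sNon : OverPartition → Maybe ℕ
sNon [] = nothing
sNon (e ∷ es) with sNon es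
... | just s  = just s
... | nothing = if 0 <ᵇ nonOver e then just (size e) else nothing

occ : ℕ → OverPartition → ℕ
occ s [] = 0
occ s (e ∷ es) = (if size e ≡ᵇ s then mult e else 0) ℕ.+ occ s es

overBigger : ℕ → OverPartition → Bool
overBigger s [] = true
overBigger s (e ∷ es) = (if over e then s <ᵇ size e else true) ∧ overBigger s es

partsAbove : ℕ → OverPartition → ℕ
partsAbove s [] = 0
partsAbove s (e ∷ es) = (if s <ᵇ size e then mult e else 0) ℕ.+ partsAbove s es

even : ℕ → Bool
even zero = true
even (suc n) = not (even n)

-- π ∈ Spt̄k(n) (with π an overpartition of n), and the parity of the
-- number of parts above s(π) is `par` (true = even)
inSptkPar : ℕ → Bool → OverPartition → Bool
inSptkPar k par π with sNon π
... | nothing = false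
... | just s  = (occ s π ≡ᵇ k) ∧ overBigger s π ∧
                (if par then even (partsAbove s π) else not (even (partsAbove s π)))

a-e : ℕ → ℕ → ℕ
a-e k n = length (filter (λ π → inSptkPar k true π ≟ᵇ true) (overpartitions n))
  where
    _≟ᵇ_ = Data.Bool._≟_
    open import Data.Bool
a-o : ℕ → ℕ → ℕ
a-o k n = length (filter (λ π → inSptkPar k false π ≟ᵇ true) (overpartitions n))
  where
    _≟ᵇ_ = Data.Bool._≟_
    open import Data.Bool

spt' : ℕ → ℕ → ℤ
spt' k n = + a-e k n ℤ.- + a-o k n

sptSeries : ℕ → PS
sptSeries k zero    = + 0
sptSeries k (suc n) = spt' k (suc n)

-- Let T_M be the generating function of spt̄k' restricted to overpartitions with parts ≤ M.
-- Conditioning on the multiplicity c ≥ 1 of a new largest part M + 1, overlined or not, multiplies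
-- the sign by (−1)^c, and 2 Σ_{c≥1} (−q^(M+1))^c = −2q^(M+1)/(1 + q^(M+1)); the only new member
-- of Spt̄k is (M+1)^k. Hence
--   (1 + q^(M+1)) T_{M+1} = (1 − q^(M+1)) T_M + (1 + q^(M+1)) q^(k(M+1)),
-- so W_k(M) = T_M (−q;q)_M + (q;q)_M satisfies W_k(M+1) = (1 − q^(M+1)) W_k(M) + q^(k(M+1)) (−q;q)_{M+1}.
-- Taking this recurrence as the definition of W_k for every k ≥ 0, induction on M gives
--   (1 + q^(k+1)) W_{k+1}(M) = (1 − q^k) W_k(M) + (q^(k(M+1)) + q^((k+1)(M+1))) (−q;q)_M.
-- Modulo q^(M+1) the last term vanishes for k ≥ 1, while for k = 0 the factor 1 − q^0 kills W_0;
-- so W_k(M) (−q;q)_k ≡ (q;q)_{k−1} (−q;q)_M by induction on k. Dividing by (−q;q)_M, and noting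
-- that the coefficients of q^n in T_M and in the products are fixed once M ≥ n, gives the identity.

module Submission where

open import Defs
open import Data.Nat using (ℕ; _∸_; _<_)
open import Relation.Binary.PropositionalEquality using (_≡_)

open import Algebra.Bundles using (CommutativeRing)
open import Algebra.Structures using (IsCommutativeRing)
import Algebra.Solver.Ring
open import Algebra.Solver.Ring.AlmostCommutativeRing
  using (fromCommutativeRing; _-Raw-AlmostCommutative⟶_)
open import Data.Bool as Bool using (Bool; true; false; if_then_else_; _∧_; not)
import Data.Bool.Properties as Boolₚ
open import Data.Integer as ℤ using (ℤ; +_; -_; _+_; _*_; _-_)
import Data.Integer.Properties as ℤₚ
open import Algebra.Properties.CommutativeSemigroup ℤₚ.+-commutativeSemigroup
  using () renaming (interchange to +-interchange)
open import Data.Integer.Tactic.RingSolver using (solve-∀)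
open import Data.List using (List; []; _∷_; _++_; map; concatMap; filter; length; null; upTo; applyUpTo)
import Data.List.Properties as Listₚ
open import Data.List.Relation.Unary.All as All using (All; []; _∷_)
import Data.List.Relation.Unary.All.Properties as Allₚ
import Data.Maybe as Maybe
open import Data.Maybe using (just; nothing)
open import Data.Maybe.Properties using (just-injective)
open import Data.Nat as ℕ using (zero; suc; _≤_; z≤n; s≤s; _≤?_; _≡ᵇ_; _<ᵇ_; NonZero)
import Data.Nat.Properties as ℕₚ
open import Data.Product using (_×_; _,_)
open import Data.Sum using (inj₁; inj₂)
open import Function using (_∘_)
open import Relation.Binary.Bundles using (Setoid)
open import Relation.Binary.PropositionalEquality
  using (refl; sym; trans; cong; cong₂; subst; _≢_; _≗_; module ≡-Reasoning)
import Relation.Binary.Reasoning.Setoid as SetoidReasoning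
open import Relation.Nullary using (Dec; yes; no; does; contradiction)
open import Relation.Nullary.Decidable using (dec-true; dec-false; dec⇒maybe)
open import Relation.Unary using (Pred; Decidable)

sumTo-cong : ∀ n {f g : ℕ → ℤ} → (∀ i → i ≤ n → f i ≡ g i) → sumTo n f ≡ sumTo n g
sumTo-cong zero    f≗g = f≗g 0 z≤n
sumTo-cong (suc n) f≗g =
  cong₂ _+_ (sumTo-cong n (λ i i≤n → f≗g i (ℕₚ.m≤n⇒m≤1+n i≤n))) (f≗g (suc n) ℕₚ.≤-refl)

sumTo-zero : ∀ n {f : ℕ → ℤ} → (∀ i → i ≤ n → f i ≡ + 0) → sumTo n f ≡ + 0
sumTo-zero zero    f≗0 = f≗0 0 z≤n
sumTo-zero (suc n) f≗0 =
  cong₂ _+_ (sumTo-zero n (λ i i≤n → f≗0 i (ℕₚ.m≤n⇒m≤1+n i≤n))) (f≗0 (suc n) ℕₚ.≤-refl)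

sumTo-+ : ∀ n (f g : ℕ → ℤ) → sumTo n (λ i → f i + g i) ≡ sumTo n f + sumTo n g
sumTo-+ zero    f g = refl
sumTo-+ (suc n) f g =
  trans (cong (_+ (f (suc n) + g (suc n))) (sumTo-+ n f g))
        (+-interchange (sumTo n f) (sumTo n g) (f (suc n)) (g (suc n)))

sumTo-*ˡ : ∀ n c (f : ℕ → ℤ) → c * sumTo n f ≡ sumTo n (λ i → c * f i)
sumTo-*ˡ zero    c f = refl
sumTo-*ˡ (suc n) c f =
  trans (ℤₚ.*-distribˡ-+ c (sumTo n f) (f (suc n))) (cong (_+ c * f (suc n)) (sumTo-*ˡ n c f))

sumTo-*ʳ : ∀ n c (f : ℕ → ℤ) → sumTo n f * c ≡ sumTo n (λ i → f i * c)
sumTo-*ʳ n c f = begin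
  sumTo n f * c               ≡⟨ ℤₚ.*-comm (sumTo n f) c ⟩
  c * sumTo n f               ≡⟨ sumTo-*ˡ n c f ⟩
  sumTo n (λ i → c * f i)     ≡⟨ sumTo-cong n (λ i _ → ℤₚ.*-comm c (f i)) ⟩
  sumTo n (λ i → f i * c)     ∎
  where open ≡-Reasoning

sumTo-suc : ∀ n (f : ℕ → ℤ) → sumTo (suc n) f ≡ f 0 + sumTo n (f ∘ suc)
sumTo-suc zero    f = refl
sumTo-suc (suc n) f =
  trans (cong (_+ f (suc (suc n))) (sumTo-suc n f)) (ℤₚ.+-assoc (f 0) _ _)

sumTo-reverse : ∀ n (f : ℕ → ℤ) → sumTo n f ≡ sumTo n (λ i → f (n ∸ i))
sumTo-reverse zero    f = refl
sumTo-reverse (suc n) f = begin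
  sumTo (suc n) f                              ≡⟨ sumTo-suc n f ⟩
  f 0 + sumTo n (f ∘ suc)                      ≡⟨ cong (_+_ (f 0)) (sumTo-reverse n (f ∘ suc)) ⟩
  f 0 + sumTo n (λ i → f (suc (n ∸ i)))        ≡⟨ ℤₚ.+-comm (f 0) _ ⟩
  sumTo n (λ i → f (suc (n ∸ i))) + f 0
    ≡⟨ cong₂ _+_ (sumTo-cong n (λ i i≤n → cong f (sym (ℕₚ.+-∸-assoc 1 i≤n))))
                 (cong f (sym (ℕₚ.n∸n≡0 n))) ⟩
  sumTo (suc n) (λ i → f (suc n ∸ i))          ∎
  where open ≡-Reasoning

sumTo-swap : ∀ n (F : ℕ → ℕ → ℤ) →
  sumTo n (λ i → sumTo i (F i)) ≡ sumTo n (λ j → sumTo (n ∸ j) (λ l → F (j ℕ.+ l) j))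
sumTo-swap zero    F = refl
sumTo-swap (suc n) F = begin
  sumTo n (λ i → sumTo i (F i)) + (sumTo n (F (suc n)) + F (suc n) (suc n))
    ≡⟨ cong (_+ (sumTo n (F (suc n)) + F (suc n) (suc n))) (sumTo-swap n F) ⟩
  R n + (sumTo n (F (suc n)) + F (suc n) (suc n))
    ≡⟨ ℤₚ.+-assoc (R n) _ _ ⟨
  (R n + sumTo n (F (suc n))) + F (suc n) (suc n)
    ≡⟨ cong₂ _+_ (sym (sumTo-+ n _ _)) corner ⟩
  sumTo n (λ j → sumTo (n ∸ j) (λ l → F (j ℕ.+ l) j) + F (suc n) j) + last
    ≡⟨ cong (_+ last) (sumTo-cong n column) ⟩
  R (suc n) + last ∎
  where
  open ≡-Reasoning
  R : ℕ → ℤ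
  R m = sumTo n (λ j → sumTo (m ∸ j) (λ l → F (j ℕ.+ l) j))
  last = sumTo (n ∸ n) (λ l → F (suc n ℕ.+ l) (suc n))
  corner : F (suc n) (suc n) ≡ last
  corner rewrite ℕₚ.n∸n≡0 n | ℕₚ.+-identityʳ n = refl
  column : ∀ j → j ≤ n →
    sumTo (n ∸ j) (λ l → F (j ℕ.+ l) j) + F (suc n) j ≡ sumTo (suc n ∸ j) (λ l → F (j ℕ.+ l) j)
  column j j≤n rewrite ℕₚ.+-∸-assoc 1 j≤n =
    cong (λ i → sumTo (n ∸ j) (λ l → F (j ℕ.+ l) j) + F i j)
         (sym (trans (ℕₚ.+-suc j (n ∸ j)) (cong suc (ℕₚ.m+[n∸m]≡n j≤n))))

sumTo-extend : ∀ {n N} (f : ℕ → ℤ) → n ≤ N → (∀ i → n < i → i ≤ N → f i ≡ + 0) →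
  sumTo N f ≡ sumTo n f
sumTo-extend {n} {N} f n≤N f≗0 with ℕₚ.m≤n⇒m<n∨m≡n n≤N
... | inj₂ refl = refl
sumTo-extend {n} {suc N} f n≤N f≗0 | inj₁ (s≤s n≤N') = begin
  sumTo N f + f (suc N)  ≡⟨ cong₂ _+_ (sumTo-extend f n≤N' (λ i n<i i≤N → f≗0 i n<i (ℕₚ.m≤n⇒m≤1+n i≤N)))
                                      (f≗0 (suc N) (s≤s n≤N') ℕₚ.≤-refl) ⟩
  sumTo n f + + 0        ≡⟨ ℤₚ.+-identityʳ _ ⟩
  sumTo n f              ∎
  where open ≡-Reasoning

sumTo-single : ∀ {n} j (f : ℕ → ℤ) → j ≤ n → (∀ i → i ≤ n → i ≢ j → f i ≡ + 0) →
  sumTo n f ≡ f j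
sumTo-single {zero}  zero f z≤n _ = refl
sumTo-single {suc n} j f j≤1+n f≗0 with ℕₚ.m≤n⇒m<n∨m≡n j≤1+n
... | inj₁ (s≤s j≤n) = begin
  sumTo n f + f (suc n)  ≡⟨ cong₂ _+_ (sumTo-single j f j≤n (λ i i≤n → f≗0 i (ℕₚ.m≤n⇒m≤1+n i≤n)))
                                      (f≗0 (suc n) ℕₚ.≤-refl (ℕₚ.>⇒≢ (s≤s j≤n))) ⟩
  f j + + 0              ≡⟨ ℤₚ.+-identityʳ _ ⟩
  f j                    ∎
  where open ≡-Reasoning
... | inj₂ refl = begin
  sumTo n f + f (suc n)  ≡⟨ cong (_+ f (suc n)) (sumTo-zero n (λ i i≤n →
                                f≗0 i (ℕₚ.m≤n⇒m≤1+n i≤n) (ℕₚ.<⇒≢ (s≤s i≤n)))) ⟩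
  + 0 + f (suc n)        ≡⟨ ℤₚ.+-identityˡ _ ⟩
  f (suc n)              ∎
  where open ≡-Reasoning

sumTo-neg : ∀ n (f : ℕ → ℤ) → sumTo n (λ i → - f i) ≡ - sumTo n f
sumTo-neg zero    f = refl
sumTo-neg (suc n) f =
  trans (cong (_+ - f (suc n)) (sumTo-neg n f)) (sym (ℤₚ.neg-distrib-+ (sumTo n f) (f (suc n))))

-- The ring of formal power series

-- Chosen so that the solver's constant `cst (+ 1)` is `one` of Defs by definition.
cst : ℤ → PS
cst c n = if 0 ≡ᵇ n then c else + 0

zeroPS : PS
zeroPS = cst (+ 0)

zeroPS-coefficient : ∀ n → zeroPS n ≡ + 0
zeroPS-coefficient zero    = refl
zeroPS-coefficient (suc n) = refl

⊛-cong : ∀ {f f′ g g′} → f ≗ f′ → g ≗ g′ → (f ⊛ g) ≗ (f′ ⊛ g′)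
⊛-cong f≗f′ g≗g′ n = sumTo-cong n (λ i _ → cong₂ _*_ (f≗f′ i) (g≗g′ (n ∸ i)))

⊛-comm : ∀ f g → (f ⊛ g) ≗ (g ⊛ f)
⊛-comm f g n = trans (sumTo-reverse n (λ i → f i * g (n ∸ i)))
  (sumTo-cong n (λ i i≤n → trans (cong (λ j → f (n ∸ i) * g j) (ℕₚ.m∸[m∸n]≡n i≤n))
                                 (ℤₚ.*-comm (f (n ∸ i)) (g i))))

⊛-assoc : ∀ f g h → ((f ⊛ g) ⊛ h) ≗ (f ⊛ (g ⊛ h))
⊛-assoc f g h n = begin
  sumTo n (λ i → sumTo i (λ j → f j * g (i ∸ j)) * h (n ∸ i))
    ≡⟨ sumTo-cong n (λ i _ → sumTo-*ʳ i (h (n ∸ i)) (λ j → f j * g (i ∸ j))) ⟩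
  sumTo n (λ i → sumTo i (λ j → f j * g (i ∸ j) * h (n ∸ i)))
    ≡⟨ sumTo-swap n (λ i j → f j * g (i ∸ j) * h (n ∸ i)) ⟩
  sumTo n (λ j → sumTo (n ∸ j) (λ l → f j * g (j ℕ.+ l ∸ j) * h (n ∸ (j ℕ.+ l))))
    ≡⟨ sumTo-cong n (λ j _ → sumTo-cong (n ∸ j) (λ l _ → reindex j l)) ⟩
  sumTo n (λ j → sumTo (n ∸ j) (λ l → f j * (g l * h (n ∸ j ∸ l))))
    ≡⟨ sumTo-cong n (λ j _ → sumTo-*ˡ (n ∸ j) (f j) (λ l → g l * h (n ∸ j ∸ l))) ⟨
  sumTo n (λ j → f j * sumTo (n ∸ j) (λ l → g l * h (n ∸ j ∸ l))) ∎
  where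
  open ≡-Reasoning
  reindex : ∀ j l → f j * g (j ℕ.+ l ∸ j) * h (n ∸ (j ℕ.+ l)) ≡ f j * (g l * h (n ∸ j ∸ l))
  reindex j l rewrite ℕₚ.m+n∸m≡n j l | ℕₚ.∸-+-assoc n j l = ℤₚ.*-assoc (f j) (g l) _

⊛-distribˡ : ∀ f g h → (f ⊛ (g ⊕ h)) ≗ ((f ⊛ g) ⊕ (f ⊛ h))
⊛-distribˡ f g h n =
  trans (sumTo-cong n (λ i _ → ℤₚ.*-distribˡ-+ (f i) (g (n ∸ i)) (h (n ∸ i))))
        (sumTo-+ n (λ i → f i * g (n ∸ i)) (λ i → f i * h (n ∸ i)))

⊛-distribʳ : ∀ f g h → ((g ⊕ h) ⊛ f) ≗ ((g ⊛ f) ⊕ (h ⊛ f))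
⊛-distribʳ f g h n =
  trans (sumTo-cong n (λ i _ → ℤₚ.*-distribʳ-+ (f (n ∸ i)) (g i) (h i)))
        (sumTo-+ n (λ i → g i * f (n ∸ i)) (λ i → h i * f (n ∸ i)))

⊛-identityˡ : ∀ f → (one ⊛ f) ≗ f
⊛-identityˡ f zero    = ℤₚ.*-identityˡ (f 0)
⊛-identityˡ f (suc n) = begin
  (one ⊛ f) (suc n)
    ≡⟨ sumTo-suc n _ ⟩
  + 1 * f (suc n) + sumTo n (λ i → + 0 * f (n ∸ i))
    ≡⟨ cong₂ _+_ (ℤₚ.*-identityˡ (f (suc n))) (sumTo-zero n (λ _ _ → refl)) ⟩
  f (suc n) + + 0
    ≡⟨ ℤₚ.+-identityʳ _ ⟩
  f (suc n) ∎
  where open ≡-Reasoning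

PS-isCommutativeRing : IsCommutativeRing _≗_ _⊕_ _⊛_ neg zeroPS one
PS-isCommutativeRing = record
  { isRing = record
    { +-isAbelianGroup = record
      { isGroup = record
        { isMonoid = record
          { isSemigroup = record
            { isMagma = record
              { isEquivalence = record
                { refl = λ _ → refl ; sym = λ p n → sym (p n) ; trans = λ p q n → trans (p n) (q n) }
              ; ∙-cong = λ p q n → cong₂ _+_ (p n) (q n) }
            ; assoc = λ f g h n → ℤₚ.+-assoc (f n) (g n) (h n) }
          ; identity = (λ f n → trans (cong (_+ f n) (zeroPS-coefficient n)) (ℤₚ.+-identityˡ (f n)))
                     , (λ f n → trans (cong (_+_ (f n)) (zeroPS-coefficient n)) (ℤₚ.+-identityʳ (f n))) }
        ; inverse = (λ f n → trans (ℤₚ.+-inverseˡ (f n)) (sym (zeroPS-coefficient n)))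
                  , (λ f n → trans (ℤₚ.+-inverseʳ (f n)) (sym (zeroPS-coefficient n)))
        ; ⁻¹-cong = λ p n → cong -_ (p n) }
      ; comm = λ f g n → ℤₚ.+-comm (f n) (g n) }
    ; *-cong = ⊛-cong
    ; *-assoc = ⊛-assoc
    ; *-identity = ⊛-identityˡ , (λ f n → trans (⊛-comm f one n) (⊛-identityˡ f n))
    ; distrib = ⊛-distribˡ , ⊛-distribʳ }
  ; *-comm = ⊛-comm }

PS-commutativeRing : CommutativeRing _ _
PS-commutativeRing = record { isCommutativeRing = PS-isCommutativeRing }

open CommutativeRing PS-commutativeRing public
  using ()
  renaming ( setoid to PS-setoid; refl to ≗-refl; sym to ≗-sym; trans to ≗-trans; +-cong to ⊕-cong
           ; *-identityʳ to ⊛-identityʳ; zeroʳ to ⊛-zeroʳ)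

⊖-cong : ∀ {f f′ g g′} → f ≗ f′ → g ≗ g′ → (f ⊖ g) ≗ (f′ ⊖ g′)
⊖-cong f≗f′ g≗g′ n = cong₂ _-_ (f≗f′ n) (g≗g′ n)

⊛-congˡ : ∀ f {g g′} → g ≗ g′ → (f ⊛ g) ≗ (f ⊛ g′)
⊛-congˡ f = ⊛-cong {f} {f} (λ _ → refl)

⊛-congʳ : ∀ h {f f′} → f ≗ f′ → (f ⊛ h) ≗ (f′ ⊛ h)
⊛-congʳ h f≗f′ = ⊛-cong {g = h} {h} f≗f′ (λ _ → refl)

module ≗-Reasoning = SetoidReasoning PS-setoid

cst-* : ∀ a b → cst (a * b) ≗ (cst a ⊛ cst b)
cst-* a b zero    = refl
cst-* a b (suc n) = sym (begin
  (cst a ⊛ cst b) (suc n)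
    ≡⟨ sumTo-suc n _ ⟩
  a * + 0 + sumTo n (λ i → + 0 * cst b (n ∸ i))
    ≡⟨ cong₂ _+_ (ℤₚ.*-zeroʳ a) (sumTo-zero n (λ _ _ → refl)) ⟩
  + 0 ∎)
  where open ≡-Reasoning

cst-homomorphism : ℤ.+-*-rawRing -Raw-AlmostCommutative⟶ fromCommutativeRing PS-commutativeRing
cst-homomorphism = record
  { ⟦_⟧    = cst
  ; +-homo = λ { a b zero → refl ; a b (suc n) → refl }
  ; *-homo = cst-*
  ; -‿homo = λ { a zero → refl ; a (suc n) → refl }
  ; 0-homo = λ { zero → refl ; (suc n) → refl }
  ; 1-homo = λ { zero → refl ; (suc n) → refl } }

module PS-Solver = Algebra.Solver.Ring ℤ.+-*-rawRing (fromCommutativeRing PS-commutativeRing) cst-homomorphism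
  (λ a b → Maybe.map (λ a≡b n → cong (λ c → cst c n) a≡b) (dec⇒maybe (a ℤₚ.≟ b)))

open PS-Solver using (solve; _:=_; _:+_; _:-_; _:*_; :-_; con; Polynomial)

𝟙 : ∀ {n} → Polynomial n
𝟙 = con (+ 1)

≡ᵇ-refl : ∀ n → (n ≡ᵇ n) ≡ true
≡ᵇ-refl n = dec-true (n ℕₚ.≟ n) refl

≡ᵇ-false : ∀ {m n} → m ≢ n → (m ≡ᵇ n) ≡ false
≡ᵇ-false {m} {n} = dec-false (m ℕₚ.≟ n)

<ᵇ-true : ∀ {m n} → m < n → (m <ᵇ n) ≡ true
<ᵇ-true {m} {n} = dec-true (m ℕₚ.<? n)

<ᵇ-false : ∀ {m n} → n ≤ m → (m <ᵇ n) ≡ false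
<ᵇ-false {m} {n} n≤m = dec-false (m ℕₚ.<? n) (ℕₚ.≤⇒≯ n≤m)

qpow-diag : ∀ j → qpow j j ≡ + 1
qpow-diag j = cong (λ b → if b then + 1 else + 0) (≡ᵇ-refl j)

qpow-≢ : ∀ {j i} → j ≢ i → qpow j i ≡ + 0
qpow-≢ j≢i = cong (λ b → if b then + 1 else + 0) (≡ᵇ-false j≢i)

qpow-⊛-≤ : ∀ {j n} f → j ≤ n → (qpow j ⊛ f) n ≡ f (n ∸ j)
qpow-⊛-≤ {j} {n} f j≤n = begin
  (qpow j ⊛ f) n        ≡⟨ sumTo-single j _ j≤n (λ i _ i≢j → cong (_* f (n ∸ i)) (qpow-≢ (i≢j ∘ sym))) ⟩
  qpow j j * f (n ∸ j)  ≡⟨ cong (_* f (n ∸ j)) (qpow-diag j) ⟩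
  + 1 * f (n ∸ j)       ≡⟨ ℤₚ.*-identityˡ _ ⟩
  f (n ∸ j)             ∎
  where open ≡-Reasoning

qpow-⊛-> : ∀ {j n} f → n < j → (qpow j ⊛ f) n ≡ + 0
qpow-⊛-> {j} {n} f n<j = sumTo-zero n (λ i i≤n →
  cong (_* f (n ∸ i)) (qpow-≢ (ℕₚ.>⇒≢ (ℕₚ.≤-<-trans i≤n n<j))))

qpow-+ : ∀ i j → qpow (i ℕ.+ j) ≗ (qpow i ⊛ qpow j)
qpow-+ i j n with i ≤? n
... | yes i≤n = sym (trans (qpow-⊛-≤ (qpow j) i≤n) (cong (λ b → if b then + 1 else + 0) (≡ᵇ-shift i i≤n)))
  where
  ≡ᵇ-shift : ∀ i {n} → i ≤ n → (j ≡ᵇ (n ∸ i)) ≡ ((i ℕ.+ j) ≡ᵇ n)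
  ≡ᵇ-shift zero    _         = refl
  ≡ᵇ-shift (suc i) (s≤s i≤n) = ≡ᵇ-shift i i≤n
... | no i≰n = trans (qpow-≢ (λ i+j≡n → i≰n (ℕₚ.m+n≤o⇒m≤o i (ℕₚ.≤-reflexive i+j≡n))))
                     (sym (qpow-⊛-> (qpow j) (ℕₚ.≰⇒> i≰n)))

qpow-*-suc : ∀ k N → qpow (k ℕ.* suc N) ≗ (qpow k ⊛ qpow (k ℕ.* N))
qpow-*-suc k N n = trans (cong (λ e → qpow e n) (ℕₚ.*-suc k N)) (qpow-+ k (k ℕ.* N) n)

-- `acc` of Defs is private; `dotFrom` is a public copy, identified with it through its defining equations
-- (in inv-suc, abstracting the arguments lets unification solve for `acc f`).
dotFrom : PS → ℕ → List ℤ → ℤ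
dotFrom f i []       = + 0
dotFrom f i (g ∷ gs) = f i * g + dotFrom f (suc i) gs

dotFrom-unique : ∀ f (A : ℕ → List ℤ → ℤ) → (∀ i → A i [] ≡ + 0) →
  (∀ i g gs → A i (g ∷ gs) ≡ f i * g + A (suc i) gs) → ∀ i gs → A i gs ≡ dotFrom f i gs
dotFrom-unique f A A[] A∷ i []       = A[] i
dotFrom-unique f A A[] A∷ i (g ∷ gs) =
  trans (A∷ i g gs) (cong (_+_ (f i * g)) (dotFrom-unique f A A[] A∷ (suc i) gs))

inv-suc : ∀ f n → inv f (suc n) ≡ - dotFrom f 1 (invRev f n)
inv-suc f n with invRev f n | 1 | dotFrom-unique f _ (λ _ → refl) (λ _ _ _ → refl)
... | gs | i | acc≡dotFrom = cong -_ (acc≡dotFrom i gs)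

dotFrom-invRev : ∀ f n i → dotFrom f i (invRev f n) ≡ sumTo n (λ t → f (i ℕ.+ t) * inv f (n ∸ t))
dotFrom-invRev f zero    i = trans (ℤₚ.+-identityʳ _) (cong (λ j → f j * + 1) (sym (ℕₚ.+-identityʳ i)))
dotFrom-invRev f (suc n) i = begin
  f i * inv f (suc n) + dotFrom f (suc i) (invRev f n)
    ≡⟨ cong₂ _+_ (cong (λ j → f j * inv f (suc n)) (sym (ℕₚ.+-identityʳ i)))
                 (trans (dotFrom-invRev f n (suc i))
                        (sumTo-cong n (λ t _ → cong (λ j → f j * inv f (n ∸ t)) (sym (ℕₚ.+-suc i t))))) ⟩
  f (i ℕ.+ 0) * inv f (suc n) + sumTo n (λ t → f (i ℕ.+ suc t) * inv f (n ∸ t))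
    ≡⟨ sumTo-suc n (λ t → f (i ℕ.+ t) * inv f (suc n ∸ t)) ⟨
  sumTo (suc n) (λ t → f (i ℕ.+ t) * inv f (suc n ∸ t)) ∎
  where open ≡-Reasoning

inv-inverseʳ : ∀ f → f 0 ≡ + 1 → (f ⊛ inv f) ≗ one
inv-inverseʳ f f₀≡1 zero    = cong (_* + 1) f₀≡1
inv-inverseʳ f f₀≡1 (suc n) = begin
  (f ⊛ inv f) (suc n)
    ≡⟨ sumTo-suc n _ ⟩
  f 0 * inv f (suc n) + sumTo n (λ t → f (suc t) * inv f (n ∸ t))
    ≡⟨ cong₂ _+_ (cong₂ _*_ f₀≡1 (inv-suc f n)) (sym (dotFrom-invRev f n 1)) ⟩
  + 1 * - dotFrom f 1 (invRev f n) + dotFrom f 1 (invRev f n)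
    ≡⟨ cancel (dotFrom f 1 (invRev f n)) ⟩
  + 0 ∎
  where
  open ≡-Reasoning
  cancel : ∀ a → + 1 * - a + a ≡ + 0
  cancel = solve-∀

inv-inverseˡ : ∀ f → f 0 ≡ + 1 → (inv f ⊛ f) ≗ one
inv-inverseˡ f f₀≡1 n = trans (⊛-comm (inv f) f n) (inv-inverseʳ f f₀≡1 n)

⊛-⊛-inv : ∀ {g} → g 0 ≡ + 1 → ∀ f → ((f ⊛ g) ⊛ inv g) ≗ f
⊛-⊛-inv {g} g₀≡1 f = begin
  (f ⊛ g) ⊛ inv g   ≈⟨ ⊛-assoc f g (inv g) ⟩
  f ⊛ (g ⊛ inv g)   ≈⟨ ⊛-congˡ f (inv-inverseʳ g g₀≡1) ⟩
  f ⊛ one           ≈⟨ ⊛-identityʳ f ⟩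
  f                 ∎
  where open ≗-Reasoning

-- Congruence modulo q^(M+1)

infix 4 _≈[_]_

_≈[_]_ : PS → ℕ → PS → Set
f ≈[ M ] g = ∀ i → i ≤ M → f i ≡ g i

≈[_]-setoid : ℕ → Setoid _ _
≈[ M ]-setoid = record
  { Carrier = PS
  ; _≈_ = λ f g → f ≈[ M ] g
  ; isEquivalence = record
    { refl  = λ _ _ → refl
    ; sym   = λ p i i≤M → sym (p i i≤M)
    ; trans = λ p q i i≤M → trans (p i i≤M) (q i i≤M) } }

module ≈-Reasoning (M : ℕ) = SetoidReasoning ≈[ M ]-setoid

≗⇒≈ : ∀ {f g M} → f ≗ g → f ≈[ M ] g
≗⇒≈ f≗g i _ = f≗g i

⊕-cong-≈ : ∀ {f f′ g g′ M} → f ≈[ M ] f′ → g ≈[ M ] g′ → (f ⊕ g) ≈[ M ] (f′ ⊕ g′)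
⊕-cong-≈ f≈f′ g≈g′ i i≤M = cong₂ _+_ (f≈f′ i i≤M) (g≈g′ i i≤M)

⊖-cong-≈ : ∀ {f f′ g g′ M} → f ≈[ M ] f′ → g ≈[ M ] g′ → (f ⊖ g) ≈[ M ] (f′ ⊖ g′)
⊖-cong-≈ f≈f′ g≈g′ i i≤M = cong₂ _-_ (f≈f′ i i≤M) (g≈g′ i i≤M)

⊕-congˡ-≈ : ∀ f {g g′ M} → g ≈[ M ] g′ → (f ⊕ g) ≈[ M ] (f ⊕ g′)
⊕-congˡ-≈ f = ⊕-cong-≈ {f} {f} (λ _ _ → refl)

⊛-cong-≈ : ∀ {f f′ g g′ M} → f ≈[ M ] f′ → g ≈[ M ] g′ → (f ⊛ g) ≈[ M ] (f′ ⊛ g′)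
⊛-cong-≈ f≈f′ g≈g′ n n≤M = sumTo-cong n (λ i i≤n →
  cong₂ _*_ (f≈f′ i (ℕₚ.≤-trans i≤n n≤M)) (g≈g′ (n ∸ i) (ℕₚ.≤-trans (ℕₚ.m∸n≤m n i) n≤M)))

⊛-congˡ-≈ : ∀ f {g g′ M} → g ≈[ M ] g′ → (f ⊛ g) ≈[ M ] (f ⊛ g′)
⊛-congˡ-≈ f = ⊛-cong-≈ {f} {f} (λ _ _ → refl)

⊛-congʳ-≈ : ∀ h {f f′ M} → f ≈[ M ] f′ → (f ⊛ h) ≈[ M ] (f′ ⊛ h)
⊛-congʳ-≈ h f≈f′ = ⊛-cong-≈ {g = h} {h} f≈f′ (λ _ _ → refl)

qpow-≈0 : ∀ {j M} → M < j → qpow j ≈[ M ] zeroPS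
qpow-≈0 M<j i i≤M = trans (qpow-≢ (ℕₚ.>⇒≢ (ℕₚ.≤-<-trans i≤M M<j))) (sym (zeroPS-coefficient i))

⊛-cancelʳ-≈ : ∀ {f g h M} → g 0 ≡ + 1 → (f ⊛ g) ≈[ M ] (h ⊛ g) → f ≈[ M ] h
⊛-cancelʳ-≈ {f} {g} {h} {M} g₀≡1 fg≈hg = begin
  f                   ≈⟨ ≗⇒≈ (⊛-⊛-inv g₀≡1 f) ⟨
  (f ⊛ g) ⊛ inv g     ≈⟨ ⊛-congʳ-≈ (inv g) fg≈hg ⟩
  (h ⊛ g) ⊛ inv g     ≈⟨ ≗⇒≈ (⊛-⊛-inv g₀≡1 h) ⟩
  h                   ∎
  where open ≈-Reasoning M

inv-cong-≈ : ∀ {f g M} → f 0 ≡ + 1 → g 0 ≡ + 1 → f ≈[ M ] g → inv f ≈[ M ] inv g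
inv-cong-≈ {f} {g} {M} f₀≡1 g₀≡1 f≈g = ⊛-cancelʳ-≈ {g = f} f₀≡1 (begin
  inv f ⊛ f   ≈⟨ ≗⇒≈ (inv-inverseˡ f f₀≡1) ⟩
  one         ≈⟨ ≗⇒≈ (inv-inverseˡ g g₀≡1) ⟨
  inv g ⊛ g   ≈⟨ ⊛-congˡ-≈ (inv g) (λ i i≤M → sym (f≈g i i≤M)) ⟩
  inv g ⊛ f   ∎)
  where open ≈-Reasoning M

poch₋ : ℕ → PS
poch₋ = poch (qpow 1)

poch₊ : ℕ → PS
poch₊ = poch (neg (qpow 1))

poch₋-suc : ∀ N → poch₋ (suc N) ≗ (poch₋ N ⊛ (one ⊖ qpow (suc N)))
poch₋-suc N = ⊛-congˡ (poch₋ N) (λ n → cong (λ c → one n - c) (sym (qpow-+ 1 N n)))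

poch₊-suc : ∀ N → poch₊ (suc N) ≗ (poch₊ N ⊛ (one ⊕ qpow (suc N)))
poch₊-suc N = ⊛-congˡ (poch₊ N) (begin
  one ⊖ (neg (qpow 1) ⊛ qpow N)
    ≈⟨ solve 2 (λ q x → 𝟙 :- (:- q) :* x := 𝟙 :+ q :* x) ≗-refl (qpow 1) (qpow N) ⟩
  one ⊕ (qpow 1 ⊛ qpow N)
    ≈⟨ ⊕-cong (≗-refl {one}) (≗-sym (qpow-+ 1 N)) ⟩
  one ⊕ qpow (suc N) ∎)
  where open ≗-Reasoning

poch-constant : ∀ a → a 0 ≡ + 0 → ∀ N → poch a N 0 ≡ + 1
poch-constant a a₀≡0 zero    = refl
poch-constant a a₀≡0 (suc N) =
  cong₂ (λ p a₀ → p * (+ 1 - a₀ * qpow N 0)) (poch-constant a a₀≡0 N) a₀≡0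

poch-suc-≈ : ∀ a → a 0 ≡ + 0 → ∀ N → poch a (suc N) ≈[ N ] poch a N
poch-suc-≈ a a₀≡0 N = begin
  poch a N ⊛ (one ⊖ (a ⊛ qpow N))   ≈⟨ ⊛-congˡ-≈ (poch a N) factor≈1 ⟩
  poch a N ⊛ one                     ≈⟨ ≗⇒≈ (⊛-identityʳ (poch a N)) ⟩
  poch a N                           ∎
  where
  open ≈-Reasoning N
  qᴺa≈0 : ∀ i → i ≤ N → (qpow N ⊛ a) i ≡ + 0
  qᴺa≈0 i i≤N with ℕₚ.m≤n⇒m<n∨m≡n i≤N
  ... | inj₁ i<N  = qpow-⊛-> a i<N
  ... | inj₂ refl = trans (qpow-⊛-≤ a i≤N) (trans (cong a (ℕₚ.n∸n≡0 i)) a₀≡0)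
  factor≈1 : (one ⊖ (a ⊛ qpow N)) ≈[ N ] one
  factor≈1 i i≤N =
    trans (cong (λ x → one i - x) (trans (⊛-comm a (qpow N) i) (qᴺa≈0 i i≤N))) (ℤₚ.+-identityʳ (one i))

poch-coefficient-stable : ∀ a → a 0 ≡ + 0 → ∀ {i M} → i ≤ M → poch a M i ≡ poch a i i
poch-coefficient-stable a a₀≡0 {i} {M} i≤M with ℕₚ.m≤n⇒m<n∨m≡n i≤M
... | inj₂ refl = refl
poch-coefficient-stable a a₀≡0 {i} {suc M} _ | inj₁ (s≤s i≤M) =
  trans (poch-suc-≈ a a₀≡0 M i i≤M) (poch-coefficient-stable a a₀≡0 i≤M)

pochInf-≈ : ∀ a → a 0 ≡ + 0 → ∀ M → pochInf a ≈[ M ] poch a M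
pochInf-≈ a a₀≡0 M i i≤M =
  trans (poch-suc-≈ a a₀≡0 i i ℕₚ.≤-refl) (sym (poch-coefficient-stable a a₀≡0 i≤M))

pochInf-quotient-≈ : ∀ M → (pochInf (qpow 1) ⊘ pochInf (neg (qpow 1))) ≈[ M ] (poch₋ M ⊘ poch₊ M)
pochInf-quotient-≈ M =
  ⊛-cong-≈ (pochInf-≈ (qpow 1) refl M)
           (inv-cong-≈ (poch-constant (neg (qpow 1)) refl 1) (poch-constant (neg (qpow 1)) refl M)
                       (pochInf-≈ (neg (qpow 1)) refl M))

-- Signed counts of overpartitions

listSum : ∀ {A : Set} → (A → ℤ) → List A → ℤ
listSum f []       = + 0
listSum f (x ∷ xs) = f x + listSum f xs

listSum-++ : ∀ {A : Set} (f : A → ℤ) xs ys → listSum f (xs ++ ys) ≡ listSum f xs + listSum f ys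
listSum-++ f []       ys = sym (ℤₚ.+-identityˡ _)
listSum-++ f (x ∷ xs) ys = trans (cong (_+_ (f x)) (listSum-++ f xs ys)) (sym (ℤₚ.+-assoc (f x) _ _))

listSum-map : ∀ {A B : Set} (f : B → ℤ) (g : A → B) xs → listSum f (map g xs) ≡ listSum (f ∘ g) xs
listSum-map f g []       = refl
listSum-map f g (x ∷ xs) = cong (_+_ (f (g x))) (listSum-map f g xs)

listSum-concatMap : ∀ {A B : Set} (f : B → ℤ) (g : A → List B) xs →
  listSum f (concatMap g xs) ≡ listSum (listSum f ∘ g) xs
listSum-concatMap f g []       = refl
listSum-concatMap f g (x ∷ xs) =
  trans (listSum-++ f (g x) (concatMap g xs)) (cong (_+_ (listSum f (g x))) (listSum-concatMap f g xs))

listSum-filter : ∀ {A : Set} {p} {P : Pred A p} (P? : Decidable P) (f : A → ℤ) xs →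
  listSum f (filter P? xs) ≡ listSum (λ x → if does (P? x) then f x else + 0) xs
listSum-filter P? f []       = refl
listSum-filter P? f (x ∷ xs) with does (P? x)
... | true  = cong (_+_ (f x)) (listSum-filter P? f xs)
... | false = trans (listSum-filter P? f xs) (sym (ℤₚ.+-identityˡ _))

listSum-cong : ∀ {A : Set} {f g : A → ℤ} → f ≗ g → ∀ xs → listSum f xs ≡ listSum g xs
listSum-cong f≗g []       = refl
listSum-cong f≗g (x ∷ xs) = cong₂ _+_ (f≗g x) (listSum-cong f≗g xs)

listSum-cong-map : ∀ {A B : Set} {f h : B → ℤ} (g : A → B) xs → (∀ x → f (g x) ≡ h (g x)) →
  listSum f (map g xs) ≡ listSum h (map g xs)
listSum-cong-map {f = f} {h} g xs fg≗hg =
  trans (listSum-map f g xs) (trans (listSum-cong fg≗hg xs) (sym (listSum-map h g xs)))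

listSum-cong-All : ∀ {A : Set} {P : A → Set} {f g : A → ℤ} {xs} → All P xs → (∀ {x} → P x → f x ≡ g x) →
  listSum f xs ≡ listSum g xs
listSum-cong-All []         f≗g = refl
listSum-cong-All (px ∷ pxs) f≗g = cong₂ _+_ (f≗g px) (listSum-cong-All pxs f≗g)

listSum-zero : ∀ {A : Set} {f : A → ℤ} xs → (∀ x → f x ≡ + 0) → listSum f xs ≡ + 0
listSum-zero []       f≗0 = refl
listSum-zero (x ∷ xs) f≗0 = cong₂ _+_ (f≗0 x) (listSum-zero xs f≗0)

listSum-+ : ∀ {A : Set} (f g : A → ℤ) xs → listSum (λ x → f x + g x) xs ≡ listSum f xs + listSum g xs
listSum-+ f g []       = refl
listSum-+ f g (x ∷ xs) =
  trans (cong (_+_ (f x + g x)) (listSum-+ f g xs)) (+-interchange (f x) (g x) (listSum f xs) (listSum g xs))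

listSum-- : ∀ {A : Set} (f g : A → ℤ) xs → listSum (λ x → f x - g x) xs ≡ listSum f xs - listSum g xs
listSum-- f g []       = refl
listSum-- f g (x ∷ xs) =
  trans (cong (_+_ (f x - g x)) (listSum-- f g xs)) (−-interchange (f x) (g x) (listSum f xs) (listSum g xs))
  where
  −-interchange : ∀ a b c d → (a - b) + (c - d) ≡ (a + c) - (b + d)
  −-interchange = solve-∀

listSum-*ˡ : ∀ {A : Set} c (f : A → ℤ) xs → listSum (λ x → c * f x) xs ≡ c * listSum f xs
listSum-*ˡ c f []       = sym (ℤₚ.*-zeroʳ c)
listSum-*ˡ c f (x ∷ xs) = trans (cong (_+_ (c * f x)) (listSum-*ˡ c f xs)) (sym (ℤₚ.*-distribˡ-+ c (f x) _))

listSum-applyUpTo : ∀ {A : Set} (f : A → ℤ) (g : ℕ → A) n → listSum f (applyUpTo g (suc n)) ≡ sumTo n (f ∘ g)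
listSum-applyUpTo f g zero    = ℤₚ.+-identityʳ (f (g 0))
listSum-applyUpTo f g (suc n) =
  trans (cong (_+_ (f (g 0))) (listSum-applyUpTo f (g ∘ suc) n)) (sym (sumTo-suc n (f ∘ g)))

sumTo-split : ∀ n (f : ℕ → ℤ) → sumTo n f ≡ f 0 + listSum f (map suc (upTo n))
sumTo-split n f = begin
  sumTo n f                               ≡⟨ listSum-applyUpTo f (λ i → i) n ⟨
  listSum f (upTo (suc n))                ≡⟨ cong (λ xs → f 0 + listSum f xs) (Listₚ.map-upTo suc n) ⟨
  f 0 + listSum f (map suc (upTo n))      ∎
  where open ≡-Reasoning

infix 8 -1^_

-1^_ : ℕ → ℤ
-1^ zero  = + 1
-1^ suc n = - -1^ n

-1^-+ : ∀ a b → -1^ (a ℕ.+ b) ≡ -1^ a * -1^ b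
-1^-+ zero    b = sym (ℤₚ.*-identityˡ (-1^ b))
-1^-+ (suc a) b = trans (cong -_ (-1^-+ a b)) (ℤₚ.neg-distribˡ-* (-1^ a) (-1^ b))

infix 8 -1^_·_

-1^_·_ : ℕ → PS → PS
(-1^ c · X) r = -1^ c * X r

-1^0-· : ∀ X → (-1^ 0 · X) ≗ X
-1^0-· X r = ℤₚ.*-identityˡ (X r)

-1^suc-· : ∀ c X → (-1^ suc c · X) ≗ neg (-1^ c · X)
-1^suc-· c X r = sym (ℤₚ.neg-distribˡ-* (-1^ c) (X r))

indicator : Bool → ℤ
indicator b = if b then + 1 else + 0

sptWeight : ℕ → OverPartition → ℤ
sptWeight k π = indicator (inSptkPar k true π) - indicator (inSptkPar k false π)

sptSign : ℕ → ℕ → OverPartition → ℤ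
sptSign k s π = if (occ s π ≡ᵇ k) ∧ overBigger s π then -1^ partsAbove s π else + 0

parity-sign : ∀ p → indicator (even p) - indicator (not (even p)) ≡ -1^ p
parity-sign zero    = refl
parity-sign (suc p) with even p | parity-sign p
... | true  | e = cong -_ e
... | false | e = cong -_ e

sptWeight-nothing : ∀ k π → sNon π ≡ nothing → sptWeight k π ≡ + 0
sptWeight-nothing k π eq with sNon π
sptWeight-nothing k π refl | nothing = refl

sptWeight-just : ∀ k π {s} → sNon π ≡ just s → sptWeight k π ≡ sptSign k s π
sptWeight-just k π eq with sNon π
sptWeight-just k π refl | just s with occ s π ≡ᵇ k | overBigger s π
... | true  | true  = parity-sign (partsAbove s π)
... | true  | false = refl
... | false | _     = refl

PartsAtMost : ℕ → OverPartition → Set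
PartsAtMost m = All (λ e → size e ≤ m × 1 ≤ mult e)

sNon-≤ : ∀ {m s} π → PartsAtMost m π → sNon π ≡ just s → s ≤ m
sNon-≤ ((s′ , c , b) ∷ π) ((s′≤m , _) ∷ bnd) eq with sNon π in eqπ
... | just _  = sNon-≤ π bnd (trans eqπ eq)
... | nothing with 0 <ᵇ nonOver (s′ , c , b)
sNon-≤ {m} _ ((s′≤m , _) ∷ _) eq | nothing | true = subst (_≤ m) (just-injective eq) s′≤m
sNon-≤ _ _ () | nothing | false

module _ {m s : ℕ} (s≤m : s ≤ m) (c : ℕ) where

  occ-cons-above : ∀ b π → occ s ((suc m , c , b) ∷ π) ≡ occ s π
  occ-cons-above b π = cong (λ t → (if t then c else 0) ℕ.+ occ s π) (≡ᵇ-false (ℕₚ.>⇒≢ (s≤s s≤m)))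

  overBigger-cons-above : ∀ b π → overBigger s ((suc m , c , b) ∷ π) ≡ overBigger s π
  overBigger-cons-above true  π rewrite <ᵇ-true (s≤s s≤m) = refl
  overBigger-cons-above false π = refl

  partsAbove-cons-above : ∀ b π → partsAbove s ((suc m , c , b) ∷ π) ≡ c ℕ.+ partsAbove s π
  partsAbove-cons-above b π = cong (λ t → (if t then c else 0) ℕ.+ partsAbove s π) (<ᵇ-true (s≤s s≤m))

  sptSign-cons-above : ∀ k b π → sptSign k s ((suc m , c , b) ∷ π) ≡ -1^ c * sptSign k s π
  sptSign-cons-above k b π rewrite occ-cons-above b π | overBigger-cons-above b π | partsAbove-cons-above b π
    with (occ s π ≡ᵇ k) ∧ overBigger s π
  ... | true  = -1^-+ c (partsAbove s π)
  ... | false = sym (ℤₚ.*-zeroʳ (-1^ c))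

occ-above : ∀ {m} π → PartsAtMost m π → occ (suc m) π ≡ 0
occ-above []                  []                = refl
occ-above {m} ((s , c , b) ∷ π) ((s≤m , _) ∷ bnd) =
  trans (cong (λ t → (if t then c else 0) ℕ.+ occ (suc m) π) (≡ᵇ-false (ℕₚ.<⇒≢ (s≤s s≤m))))
        (occ-above π bnd)

partsAbove-above : ∀ {m} π → PartsAtMost m π → partsAbove (suc m) π ≡ 0
partsAbove-above []                  []                = refl
partsAbove-above {m} ((s , c , b) ∷ π) ((s≤m , _) ∷ bnd) =
  trans (cong (λ t → (if t then c else 0) ℕ.+ partsAbove (suc m) π) (<ᵇ-false (ℕₚ.m≤n⇒m≤1+n s≤m)))
        (partsAbove-above π bnd)

-- π consists of overlined parts ≤ m only.
overBigger-above : ∀ {m} π → PartsAtMost m π → sNon π ≡ nothing → overBigger (suc m) π ≡ null π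
overBigger-above [] [] _ = refl
overBigger-above ((s , c , b) ∷ π) ((s≤m , 1≤c) ∷ _) eq with sNon π
overBigger-above _ _ () | just _
overBigger-above ((s , suc c , false) ∷ π) _ () | nothing
overBigger-above {m} ((s , c , true) ∷ π) ((s≤m , _) ∷ _) _ | nothing =
  cong (_∧ overBigger (suc m) π) (<ᵇ-false (ℕₚ.m≤n⇒m≤1+n s≤m))

sNon-cons-just : ∀ e π {s} → sNon π ≡ just s → sNon (e ∷ π) ≡ just s
sNon-cons-just e π eq with sNon π
sNon-cons-just e π refl | just s = refl

sNon-cons-nothing : ∀ e π → sNon π ≡ nothing →
  sNon (e ∷ π) ≡ (if 0 <ᵇ nonOver e then just (size e) else nothing)
sNon-cons-nothing e π eq with sNon π
sNon-cons-nothing e π refl | nothing = refl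

null-sNon-just : ∀ π {s} → sNon π ≡ just s → null π ≡ false
null-sNon-just (_ ∷ _) _ = refl

sptWeight-cons-new : ∀ k {m} c b π → PartsAtMost m π → sNon π ≡ nothing →
  sptWeight k ((suc m , suc c , b) ∷ π) ≡ indicator (not b ∧ (suc c ≡ᵇ k) ∧ null π)
sptWeight-cons-new k {m} c false π bnd eq =
  trans (sptWeight-just k (e ∷ π) (sNon-cons-nothing e π eq)) sign
  where
  e = (suc m , suc c , false)
  sign : sptSign k (suc m) (e ∷ π) ≡ indicator ((suc c ≡ᵇ k) ∧ null π)
  sign rewrite ≡ᵇ-refl m | occ-above π bnd | ℕₚ.+-identityʳ c | overBigger-above π bnd eq
             | <ᵇ-false {m} ℕₚ.≤-refl | partsAbove-above π bnd = refl
sptWeight-cons-new k {m} zero    true π bnd eq =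
  sptWeight-nothing k ((suc m , 1 , true) ∷ π) (sNon-cons-nothing (suc m , 1 , true) π eq)
sptWeight-cons-new k {m} (suc c) true π bnd eq =
  trans (sptWeight-just k (e ∷ π) (sNon-cons-nothing e π eq)) sign
  where
  e = (suc m , suc (suc c) , true)
  sign : sptSign k (suc m) (e ∷ π) ≡ + 0
  sign rewrite <ᵇ-false {m} ℕₚ.≤-refl | Boolₚ.∧-zeroʳ (occ (suc m) (e ∷ π) ≡ᵇ k) = refl

-- If π has a non-overlined part, the c + 1 new parts lie above s(π) and only flip the sign;
-- otherwise they become the smallest non-overlined parts, which yields an element of Spt̄k only
-- for the overpartition made of k non-overlined copies of m + 1 alone.
sptWeight-cons : ∀ k {m} c b π → PartsAtMost m π →
  sptWeight k ((suc m , suc c , b) ∷ π)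
    ≡ -1^ suc c * sptWeight k π + indicator (not b ∧ (suc c ≡ᵇ k) ∧ null π)
sptWeight-cons k {m} c b π bnd = by-sNon (sNon π) refl
  where
  open ≡-Reasoning
  e = (suc m , suc c , b)
  new = indicator (not b ∧ (suc c ≡ᵇ k) ∧ null π)
  by-sNon : ∀ r → sNon π ≡ r → sptWeight k (e ∷ π) ≡ -1^ suc c * sptWeight k π + new
  by-sNon (just s) eq = begin
    sptWeight k (e ∷ π)                 ≡⟨ sptWeight-just k (e ∷ π) (sNon-cons-just e π eq) ⟩
    sptSign k s (e ∷ π)                 ≡⟨ sptSign-cons-above (sNon-≤ π bnd eq) (suc c) k b π ⟩
    -1^ suc c * sptSign k s π           ≡⟨ cong (-1^ suc c *_) (sptWeight-just k π eq) ⟨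
    -1^ suc c * sptWeight k π           ≡⟨ ℤₚ.+-identityʳ _ ⟨
    -1^ suc c * sptWeight k π + + 0     ≡⟨ cong (λ t → -1^ suc c * sptWeight k π + indicator t) absent ⟨
    -1^ suc c * sptWeight k π + new     ∎
    where
    absent : (not b ∧ (suc c ≡ᵇ k) ∧ null π) ≡ false
    absent rewrite null-sNon-just π eq | Boolₚ.∧-zeroʳ (suc c ≡ᵇ k) = Boolₚ.∧-zeroʳ (not b)
  by-sNon nothing eq = begin
    sptWeight k (e ∷ π)                 ≡⟨ sptWeight-cons-new k c b π bnd eq ⟩
    new                                 ≡⟨ ℤₚ.+-identityˡ new ⟨
    + 0 + new                           ≡⟨ cong (_+ new) (ℤₚ.*-zeroʳ (-1^ suc c)) ⟨
    -1^ suc c * + 0 + new               ≡⟨ cong (λ w → -1^ suc c * w + new) (sptWeight-nothing k π eq) ⟨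
    -1^ suc c * sptWeight k π + new     ∎

sptBounded : ℕ → ℕ → PS
sptBounded k m n = listSum (sptWeight k) (opsBounded m n)

sptSeries≡sptBounded : ∀ k n → sptSeries k n ≡ sptBounded k n n
sptSeries≡sptBounded k zero    = refl
sptSeries≡sptBounded k (suc n) = begin
  + count true - + count false
    ≡⟨ cong₂ _-_ (count≡ (inSptkPar k true) L) (count≡ (inSptkPar k false) L) ⟩
  listSum (indicator ∘ inSptkPar k true) L - listSum (indicator ∘ inSptkPar k false) L
    ≡⟨ listSum-- (indicator ∘ inSptkPar k true) (indicator ∘ inSptkPar k false) L ⟨
  listSum (sptWeight k) L ∎
  where
  open ≡-Reasoning
  L = overpartitions (suc n)
  count : Bool → ℕ
  count par = length (filter (λ π → inSptkPar k par π Bool.≟ true) L)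
  count≡ : ∀ (p : OverPartition → Bool) xs →
    + length (filter (λ π → p π Bool.≟ true) xs) ≡ listSum (indicator ∘ p) xs
  count≡ p []       = refl
  count≡ p (π ∷ xs) with p π
  ... | true  = cong (_+_ (+ 1)) (count≡ p xs)
  ... | false = trans (count≡ p xs) (sym (ℤₚ.+-identityˡ _))

sptBounded-zero : ∀ k → sptBounded k 0 ≗ zeroPS
sptBounded-zero k zero    = refl
sptBounded-zero k (suc n) = refl

concatMap⁺ : ∀ {A B : Set} {P : B → Set} {f : A → List B} {xs} →
  All (All P ∘ f) xs → All P (concatMap f xs)
concatMap⁺ = Allₚ.concat⁺ ∘ Allₚ.map⁺

opsBounded-partsAtMost : ∀ m n → All (PartsAtMost m) (opsBounded m n)
opsBounded-partsAtMost zero    zero    = [] ∷ []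
opsBounded-partsAtMost zero    (suc n) = []
opsBounded-partsAtMost (suc m) n =
  Allₚ.++⁺ (All.map weaken (opsBounded-partsAtMost m n)) (concatMap⁺ (All.map withLargest multiplicities))
  where
  weaken : ∀ {π} → PartsAtMost m π → PartsAtMost (suc m) π
  weaken = All.map (λ (s≤m , 1≤c) → ℕₚ.m≤n⇒m≤1+n s≤m , 1≤c)
  multiplicities : All (1 ≤_) (filter (λ c → c ℕ.* suc m ≤? n) (map suc (upTo n)))
  multiplicities =
    Allₚ.filter⁺ (λ c → c ℕ.* suc m ≤? n) (Allₚ.map⁺ (All.universal (λ _ → s≤s z≤n) (upTo n)))
  withLargest : ∀ {c} → 1 ≤ c → All (PartsAtMost (suc m))
    (concatMap (λ b → map ((suc m , c , b) ∷_) (opsBounded m (n ∸ c ℕ.* suc m))) (false ∷ true ∷ []))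
  withLargest {c} 1≤c = concatMap⁺ (All.universal (λ b → Allₚ.map⁺ {f = (suc m , c , b) ∷_}
    (All.map (λ bnd → (ℕₚ.≤-refl , 1≤c) ∷ weaken bnd) (opsBounded-partsAtMost m (n ∸ c ℕ.* suc m))))
    (false ∷ true ∷ []))

opsBounded-null-count : ∀ m n → listSum (indicator ∘ null) (opsBounded m n) ≡ one n
opsBounded-null-count zero    zero    = refl
opsBounded-null-count zero    (suc n) = refl
opsBounded-null-count (suc m) n = begin
  listSum (indicator ∘ null) (opsBounded m n ++ concatMap G cs)
    ≡⟨ listSum-++ (indicator ∘ null) (opsBounded m n) (concatMap G cs) ⟩
  listSum (indicator ∘ null) (opsBounded m n) + listSum (indicator ∘ null) (concatMap G cs)
    ≡⟨ cong₂ _+_ (opsBounded-null-count m n) nonempty ⟩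
  one n + + 0
    ≡⟨ ℤₚ.+-identityʳ (one n) ⟩
  one n ∎
  where
  open ≡-Reasoning
  cs = filter (λ c → c ℕ.* suc m ≤? n) (map suc (upTo n))
  with-largest : ℕ → Bool → List OverPartition
  with-largest c b = map ((suc m , c , b) ∷_) (opsBounded m (n ∸ c ℕ.* suc m))
  G : ℕ → List OverPartition
  G c = concatMap (with-largest c) (false ∷ true ∷ [])
  nonempty : listSum (indicator ∘ null) (concatMap G cs) ≡ + 0
  nonempty = trans (listSum-concatMap (indicator ∘ null) G cs) (listSum-zero cs λ c →
    trans (listSum-concatMap (indicator ∘ null) (with-largest c) (false ∷ true ∷ []))
          (listSum-zero (false ∷ true ∷ []) λ b →
            trans (listSum-map (indicator ∘ null) ((suc m , c , b) ∷_) (opsBounded m (n ∸ c ℕ.* suc m)))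
                  (listSum-zero (opsBounded m (n ∸ c ℕ.* suc m)) (λ _ → refl))))

-- The recurrence in the largest part

-- generating function of the rest of an overpartition whose largest part m + 1 occurs c times
afterLargest : ℕ → ℕ → ℕ → PS
afterLargest k m zero    = sptBounded k m
afterLargest k m (suc c) =
  ((-1^ suc c · sptBounded k m) ⊕ (if suc c ≡ᵇ k then one else zeroPS)) ⊕ (-1^ suc c · sptBounded k m)

sptBounded-multiplicity : ∀ k m c r →
  listSum (sptWeight k) (concatMap (λ b → map ((suc m , suc c , b) ∷_) (opsBounded m r)) (false ∷ true ∷ []))
    ≡ afterLargest k m (suc c) r
sptBounded-multiplicity k m c r = begin
  listSum (sptWeight k) (map (entry false ∷_) L ++ (map (entry true ∷_) L ++ []))
    ≡⟨ listSum-++ (sptWeight k) (map (entry false ∷_) L) _ ⟩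
  listSum (sptWeight k) (map (entry false ∷_) L) + listSum (sptWeight k) (map (entry true ∷_) L ++ [])
    ≡⟨ cong (_+_ (listSum (sptWeight k) (map (entry false ∷_) L)))
            (trans (listSum-++ (sptWeight k) (map (entry true ∷_) L) []) (ℤₚ.+-identityʳ _)) ⟩
  listSum (sptWeight k) (map (entry false ∷_) L) + listSum (sptWeight k) (map (entry true ∷_) L)
    ≡⟨ cong₂ _+_ (with-entry false) (with-entry true) ⟩
  (signed + alone false) + (signed + alone true)
    ≡⟨ cong₂ (λ u v → (signed + u) + (signed + v)) alone-false alone-true ⟩
  (signed + A r) + (signed + + 0)
    ≡⟨ cong (_+_ (signed + A r)) (ℤₚ.+-identityʳ signed) ⟩
  (signed + A r) + signed ∎
  where
  open ≡-Reasoning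
  entry : Bool → Entry
  entry b = (suc m , suc c , b)
  L = opsBounded m r
  signed = -1^ suc c * sptBounded k m r
  A = if suc c ≡ᵇ k then one else zeroPS
  alone : Bool → ℤ
  alone b = listSum (λ π → indicator (not b ∧ (suc c ≡ᵇ k) ∧ null π)) L
  with-entry : ∀ b → listSum (sptWeight k) (map (entry b ∷_) L) ≡ signed + alone b
  with-entry b = begin
    listSum (sptWeight k) (map (entry b ∷_) L)
      ≡⟨ listSum-map (sptWeight k) (entry b ∷_) L ⟩
    listSum (λ π → sptWeight k (entry b ∷ π)) L
      ≡⟨ listSum-cong-All (opsBounded-partsAtMost m r) (λ {π} bnd → sptWeight-cons k c b π bnd) ⟩
    listSum (λ π → -1^ suc c * sptWeight k π + indicator (not b ∧ (suc c ≡ᵇ k) ∧ null π)) L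
      ≡⟨ listSum-+ (λ π → -1^ suc c * sptWeight k π) _ L ⟩
    listSum (λ π → -1^ suc c * sptWeight k π) L + alone b
      ≡⟨ cong (_+ alone b) (listSum-*ˡ (-1^ suc c) (sptWeight k) L) ⟩
    signed + alone b ∎
  alone-false : alone false ≡ A r
  alone-false with suc c ≡ᵇ k
  ... | true  = opsBounded-null-count m r
  ... | false = trans (listSum-zero L (λ _ → refl)) (sym (zeroPS-coefficient r))
  alone-true : alone true ≡ + 0
  alone-true = listSum-zero L (λ _ → refl)

-- Σ_c q^(c·d) g c, truncated along the diagonal: for d ≥ 1 only c ≤ n contributes to q^n.
partsSeries : ℕ → (ℕ → PS) → PS
partsSeries d g n = sumTo n (λ c → (qpow (c ℕ.* d) ⊛ g c) n)

sptBounded-suc : ∀ k m → sptBounded k (suc m) ≗ partsSeries (suc m) (afterLargest k m)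
sptBounded-suc k m n = begin
  listSum (sptWeight k) (opsBounded m n ++ concatMap G cs)
    ≡⟨ listSum-++ (sptWeight k) (opsBounded m n) (concatMap G cs) ⟩
  X n + listSum (sptWeight k) (concatMap G cs)
    ≡⟨ cong (_+_ (X n)) (listSum-concatMap (sptWeight k) G cs) ⟩
  X n + listSum (listSum (sptWeight k) ∘ G) cs
    ≡⟨ cong (_+_ (X n)) (listSum-filter (λ c → c ℕ.* d ≤? n) (listSum (sptWeight k) ∘ G) (map suc (upTo n))) ⟩
  X n + listSum (λ c → if does (c ℕ.* d ≤? n) then listSum (sptWeight k) (G c) else + 0) (map suc (upTo n))
    ≡⟨ cong (_+_ (X n)) (listSum-cong-map suc (upTo n) term) ⟩
  X n + listSum φ (map suc (upTo n))
    ≡⟨ cong (_+ listSum φ (map suc (upTo n))) (⊛-identityˡ X n) ⟨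
  φ 0 + listSum φ (map suc (upTo n))
    ≡⟨ sumTo-split n φ ⟨
  partsSeries d (afterLargest k m) n ∎
  where
  open ≡-Reasoning
  d = suc m
  X = sptBounded k m
  cs = filter (λ c → c ℕ.* d ≤? n) (map suc (upTo n))
  G : ℕ → List OverPartition
  G c = concatMap (λ b → map ((d , c , b) ∷_) (opsBounded m (n ∸ c ℕ.* d))) (false ∷ true ∷ [])
  φ : ℕ → ℤ
  φ c = (qpow (c ℕ.* d) ⊛ afterLargest k m c) n
  term : ∀ c → (if does (suc c ℕ.* d ≤? n) then listSum (sptWeight k) (G (suc c)) else + 0) ≡ φ (suc c)
  term c = by-decision (suc c ℕ.* d ≤? n)
    where
    by-decision : (cd≤?n : Dec (suc c ℕ.* d ≤ n)) →
      (if does cd≤?n then listSum (sptWeight k) (G (suc c)) else + 0) ≡ φ (suc c)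
    by-decision (yes cd≤n) =
      trans (sptBounded-multiplicity k m c (n ∸ suc c ℕ.* d)) (sym (qpow-⊛-≤ (afterLargest k m (suc c)) cd≤n))
    by-decision (no cd≰n) = sym (qpow-⊛-> (afterLargest k m (suc c)) (ℕₚ.≰⇒> cd≰n))

partsSeries-cong : ∀ d {g g′ : ℕ → PS} → (∀ c → g c ≗ g′ c) → partsSeries d g ≗ partsSeries d g′
partsSeries-cong d g≗g′ n = sumTo-cong n (λ c _ → ⊛-congˡ (qpow (c ℕ.* d)) (g≗g′ c) n)

partsSeries-⊕ : ∀ d (g h : ℕ → PS) → partsSeries d (λ c → g c ⊕ h c) ≗ (partsSeries d g ⊕ partsSeries d h)
partsSeries-⊕ d g h n = trans (sumTo-cong n (λ c _ → ⊛-distribˡ (qpow (c ℕ.* d)) (g c) (h c) n))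
                              (sumTo-+ n (λ c → (qpow (c ℕ.* d) ⊛ g c) n) (λ c → (qpow (c ℕ.* d) ⊛ h c) n))

partsSeries-single : ∀ d .{{_ : NonZero d}} j f →
  partsSeries d (λ c → if c ≡ᵇ j then f else zeroPS) ≗ (qpow (j ℕ.* d) ⊛ f)
partsSeries-single d j f n = by-decision (j ≤? n)
  where
  off : ∀ {c} → c ≢ j → (qpow (c ℕ.* d) ⊛ (if c ≡ᵇ j then f else zeroPS)) n ≡ + 0
  off {c} c≢j rewrite ≡ᵇ-false c≢j = trans (⊛-zeroʳ (qpow (c ℕ.* d)) n) (zeroPS-coefficient n)
  by-decision : Dec (j ≤ n) → partsSeries d (λ c → if c ≡ᵇ j then f else zeroPS) n ≡ (qpow (j ℕ.* d) ⊛ f) n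
  by-decision (yes j≤n) = trans (sumTo-single j _ j≤n (λ c _ c≢j → off c≢j))
                                (cong (λ b → (qpow (j ℕ.* d) ⊛ (if b then f else zeroPS)) n) (≡ᵇ-refl j))
  by-decision (no j≰n) = trans (sumTo-zero n (λ c c≤n → off (ℕₚ.<⇒≢ (ℕₚ.≤-<-trans c≤n (ℕₚ.≰⇒> j≰n)))))
                               (sym (qpow-⊛-> f (ℕₚ.<-≤-trans (ℕₚ.≰⇒> j≰n) (ℕₚ.m≤m*n j d))))

alternating : ℕ → PS → PS
alternating d X = partsSeries d (λ c → -1^ c · X)

alternating-shift : ∀ d X c {n} → d ≤ n →
  (qpow (suc c ℕ.* d) ⊛ (-1^ suc c · X)) n ≡ - (qpow (c ℕ.* d) ⊛ (-1^ c · X)) (n ∸ d)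
alternating-shift d X c {n} d≤n = begin
  (qpow (d ℕ.+ c ℕ.* d) ⊛ (-1^ suc c · X)) n
    ≡⟨ ⊛-congʳ (-1^ suc c · X) {qpow (d ℕ.+ c ℕ.* d)} {qpow d ⊛ qpow (c ℕ.* d)} (qpow-+ d (c ℕ.* d)) n ⟩
  ((qpow d ⊛ qpow (c ℕ.* d)) ⊛ (-1^ suc c · X)) n
    ≡⟨ ⊛-assoc (qpow d) (qpow (c ℕ.* d)) (-1^ suc c · X) n ⟩
  (qpow d ⊛ (qpow (c ℕ.* d) ⊛ (-1^ suc c · X))) n
    ≡⟨ qpow-⊛-≤ (qpow (c ℕ.* d) ⊛ (-1^ suc c · X)) d≤n ⟩
  (qpow (c ℕ.* d) ⊛ (-1^ suc c · X)) (n ∸ d)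
    ≡⟨ ⊛-congˡ (qpow (c ℕ.* d)) (-1^suc-· c X) (n ∸ d) ⟩
  (qpow (c ℕ.* d) ⊛ neg (-1^ c · X)) (n ∸ d)
    ≡⟨ solve 2 (λ x y → x :* (:- y) := :- (x :* y)) ≗-refl (qpow (c ℕ.* d)) (-1^ c · X) (n ∸ d) ⟩
  - (qpow (c ℕ.* d) ⊛ (-1^ c · X)) (n ∸ d) ∎
  where open ≡-Reasoning

alternating-below : ∀ d .{{_ : NonZero d}} X {n} → n < d → alternating d X n ≡ X n
alternating-below d X {n} n<d = begin
  sumTo n φ                 ≡⟨ sumTo-extend {N = n} φ z≤n (λ c 0<c _ → qpow-⊛-> (-1^ c · X) (d≤c*d c 0<c)) ⟩
  (one ⊛ (-1^ 0 · X)) n     ≡⟨ ⊛-identityˡ (-1^ 0 · X) n ⟩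
  (-1^ 0 · X) n             ≡⟨ -1^0-· X n ⟩
  X n                       ∎
  where
  open ≡-Reasoning
  φ : ℕ → ℤ
  φ c = (qpow (c ℕ.* d) ⊛ (-1^ c · X)) n
  d≤c*d : ∀ c → 0 < c → n < c ℕ.* d
  d≤c*d c 0<c = ℕₚ.<-≤-trans n<d (ℕₚ.m≤n*m d c {{ℕ.>-nonZero 0<c}})

alternating-rec : ∀ d .{{_ : NonZero d}} X {n} → d ≤ n → alternating d X n ≡ X n - alternating d X (n ∸ d)
alternating-rec d X {zero} d≤0 = contradiction (ℕₚ.≤-trans (ℕ.>-nonZero⁻¹ d) d≤0) λ ()
alternating-rec d X {suc n} d≤n = begin
  sumTo (suc n) φ
    ≡⟨ sumTo-suc n φ ⟩
  φ 0 + sumTo n (φ ∘ suc)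
    ≡⟨ cong₂ _+_ (trans (⊛-identityˡ (-1^ 0 · X) (suc n)) (-1^0-· X (suc n)))
                 (sumTo-cong n (λ c _ → alternating-shift d X c d≤n)) ⟩
  X (suc n) + sumTo n (λ c → - ψ c)
    ≡⟨ cong (_+_ (X (suc n))) (sumTo-neg n ψ) ⟩
  X (suc n) - sumTo n ψ
    ≡⟨ cong (_-_ (X (suc n))) (sumTo-extend ψ n-d≤n (λ c n-d<c _ → qpow-⊛-> (-1^ c · X) (beyond c n-d<c))) ⟩
  X (suc n) - alternating d X (suc n ∸ d) ∎
  where
  open ≡-Reasoning
  φ ψ : ℕ → ℤ
  φ c = (qpow (c ℕ.* d) ⊛ (-1^ c · X)) (suc n)
  ψ c = (qpow (c ℕ.* d) ⊛ (-1^ c · X)) (suc n ∸ d)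
  n-d≤n : suc n ∸ d ≤ n
  n-d≤n = ℕₚ.∸-monoʳ-≤ (suc n) (ℕ.>-nonZero⁻¹ d)
  beyond : ∀ c → suc n ∸ d < c → suc n ∸ d < c ℕ.* d
  beyond c n-d<c = ℕₚ.<-≤-trans n-d<c (ℕₚ.m≤m*n c d)

alternating-geometric : ∀ d .{{_ : NonZero d}} X → ((one ⊕ qpow d) ⊛ alternating d X) ≗ X
alternating-geometric d X n = begin
  ((one ⊕ qpow d) ⊛ A) n                    ≡⟨ ⊛-distribʳ A one (qpow d) n ⟩
  (one ⊛ A) n + (qpow d ⊛ A) n              ≡⟨ cong (_+ (qpow d ⊛ A) n) (⊛-identityˡ A n) ⟩
  A n + (qpow d ⊛ A) n                      ≡⟨ by-decision (d ≤? n) ⟩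
  X n                                       ∎
  where
  open ≡-Reasoning
  A = alternating d X
  by-decision : Dec (d ≤ n) → A n + (qpow d ⊛ A) n ≡ X n
  by-decision (yes d≤n) = begin
    A n + (qpow d ⊛ A) n                    ≡⟨ cong₂ _+_ (alternating-rec d X d≤n) (qpow-⊛-≤ A d≤n) ⟩
    (X n - A (n ∸ d)) + A (n ∸ d)           ≡⟨ cancel (X n) (A (n ∸ d)) ⟩
    X n                                     ∎
    where
    cancel : ∀ a b → (a - b) + b ≡ a
    cancel = solve-∀
  by-decision (no d≰n) = let n<d = ℕₚ.≰⇒> d≰n in begin
    A n + (qpow d ⊛ A) n                    ≡⟨ cong₂ _+_ (alternating-below d X n<d) (qpow-⊛-> A n<d) ⟩
    X n + + 0                               ≡⟨ ℤₚ.+-identityʳ (X n) ⟩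
    X n                                     ∎

sptBounded-suc-⊕ : ∀ k m →
  (sptBounded (suc k) (suc m) ⊕ sptBounded (suc k) m)
    ≗ ((alternating (suc m) (sptBounded (suc k) m) ⊕ alternating (suc m) (sptBounded (suc k) m))
        ⊕ qpow (suc k ℕ.* suc m))
sptBounded-suc-⊕ k m = begin
  Y ⊕ X
    ≈⟨ ⊕-cong (sptBounded-suc (suc k) m) (≗-trans (≗-sym (⊛-identityˡ X)) (≗-sym (partsSeries-single d 0 X))) ⟩
  partsSeries d (afterLargest (suc k) m) ⊕ partsSeries d (λ c → if c ≡ᵇ 0 then X else zeroPS)
    ≈⟨ partsSeries-⊕ d (afterLargest (suc k) m) (λ c → if c ≡ᵇ 0 then X else zeroPS) ⟨
  partsSeries d (λ c → afterLargest (suc k) m c ⊕ (if c ≡ᵇ 0 then X else zeroPS))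
    ≈⟨ partsSeries-cong d regroup ⟩
  partsSeries d (λ c → ((-1^ c · X) ⊕ (-1^ c · X)) ⊕ (if c ≡ᵇ suc k then one else zeroPS))
    ≈⟨ partsSeries-⊕ d (λ c → (-1^ c · X) ⊕ (-1^ c · X)) (λ c → if c ≡ᵇ suc k then one else zeroPS) ⟩
  partsSeries d (λ c → (-1^ c · X) ⊕ (-1^ c · X)) ⊕ partsSeries d (λ c → if c ≡ᵇ suc k then one else zeroPS)
    ≈⟨ ⊕-cong (partsSeries-⊕ d (λ c → -1^ c · X) (λ c → -1^ c · X))
              (≗-trans (partsSeries-single d (suc k) one) (⊛-identityʳ (qpow (suc k ℕ.* d)))) ⟩
  (alternating d X ⊕ alternating d X) ⊕ qpow (suc k ℕ.* d) ∎
  where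
  open ≗-Reasoning
  d = suc m
  Y = sptBounded (suc k) d
  X = sptBounded (suc k) m
  regroup : ∀ c → (afterLargest (suc k) m c ⊕ (if c ≡ᵇ 0 then X else zeroPS))
                    ≗ (((-1^ c · X) ⊕ (-1^ c · X)) ⊕ (if c ≡ᵇ suc k then one else zeroPS))
  regroup zero = ≗-trans (solve 1 (λ x → x :+ x := (x :+ x) :+ con (+ 0)) ≗-refl X)
                         (⊕-cong (⊕-cong (≗-sym (-1^0-· X)) (≗-sym (-1^0-· X))) (≗-refl {zeroPS}))
  regroup (suc c) = solve 2 (λ s e → ((s :+ e) :+ s) :+ con (+ 0) := (s :+ s) :+ e) ≗-refl
                            (-1^ suc c · X) (if suc c ≡ᵇ suc k then one else zeroPS)

sptBounded-recurrence : ∀ k m →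
  ((one ⊕ qpow (suc m)) ⊛ sptBounded (suc k) (suc m))
    ≗ (((one ⊖ qpow (suc m)) ⊛ sptBounded (suc k) m) ⊕ ((one ⊕ qpow (suc m)) ⊛ qpow (suc k ℕ.* suc m)))
sptBounded-recurrence k m = begin
  (one ⊕ x) ⊛ Y
    ≈⟨ solve 3 (λ x y z → (𝟙 :+ x) :* y := (𝟙 :+ x) :* (y :+ z) :- (𝟙 :+ x) :* z) ≗-refl x Y X ⟩
  ((one ⊕ x) ⊛ (Y ⊕ X)) ⊖ ((one ⊕ x) ⊛ X)
    ≈⟨ ⊖-cong (⊛-congˡ (one ⊕ x) (sptBounded-suc-⊕ k m)) (≗-refl {(one ⊕ x) ⊛ X}) ⟩
  ((one ⊕ x) ⊛ ((A ⊕ A) ⊕ Q)) ⊖ ((one ⊕ x) ⊛ X)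
    ≈⟨ solve 4 (λ x a q X → (𝟙 :+ x) :* ((a :+ a) :+ q) :- (𝟙 :+ x) :* X
                          := ((𝟙 :+ x) :* a :+ (𝟙 :+ x) :* a) :+ (𝟙 :+ x) :* q :- (𝟙 :+ x) :* X) ≗-refl x A Q X ⟩
  ((((one ⊕ x) ⊛ A) ⊕ ((one ⊕ x) ⊛ A)) ⊕ ((one ⊕ x) ⊛ Q)) ⊖ ((one ⊕ x) ⊛ X)
    ≈⟨ ⊖-cong (⊕-cong (⊕-cong geometric geometric) (≗-refl {(one ⊕ x) ⊛ Q})) (≗-refl {(one ⊕ x) ⊛ X}) ⟩
  ((X ⊕ X) ⊕ ((one ⊕ x) ⊛ Q)) ⊖ ((one ⊕ x) ⊛ X)
    ≈⟨ solve 3 (λ x q X → (X :+ X) :+ (𝟙 :+ x) :* q :- (𝟙 :+ x) :* X := (𝟙 :- x) :* X :+ (𝟙 :+ x) :* q)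
               ≗-refl x Q X ⟩
  ((one ⊖ x) ⊛ X) ⊕ ((one ⊕ x) ⊛ Q) ∎
  where
  open ≗-Reasoning
  x = qpow (suc m)
  Y = sptBounded (suc k) (suc m)
  X = sptBounded (suc k) m
  A = alternating (suc m) X
  Q = qpow (suc k ℕ.* suc m)
  geometric : ((one ⊕ x) ⊛ A) ≗ X
  geometric = alternating-geometric (suc m) X

-- For k ≥ 1 this is sptBounded k M ⊛ poch₊ M ⊕ poch₋ M (sptBounded-W); W 0 only starts the induction on k.
W : ℕ → ℕ → PS
W k zero    = one
W k (suc M) = ((one ⊖ qpow (suc M)) ⊛ W k M) ⊕ (qpow (k ℕ.* suc M) ⊛ poch₊ (suc M))

W-shift : ∀ k M →
  ((one ⊕ qpow (suc k)) ⊛ W (suc k) M)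
    ≗ (((one ⊖ qpow k) ⊛ W k M) ⊕ ((qpow (k ℕ.* suc M) ⊕ qpow (suc k ℕ.* suc M)) ⊛ poch₊ M))
W-shift k zero = begin
  (one ⊕ z) ⊛ one
    ≈⟨ solve 2 (λ y z → (𝟙 :+ z) :* 𝟙 := (𝟙 :- y) :* 𝟙 :+ (y :+ z) :* 𝟙) ≗-refl y z ⟩
  ((one ⊖ y) ⊛ one) ⊕ ((y ⊕ z) ⊛ one)
    ≈⟨ ⊕-cong (≗-refl {(one ⊖ y) ⊛ one}) (⊛-congʳ one (⊕-cong (q-*1 k) (q-*1 (suc k)))) ⟨
  ((one ⊖ y) ⊛ one) ⊕ ((qpow (k ℕ.* 1) ⊕ qpow (suc k ℕ.* 1)) ⊛ one) ∎
  where
  open ≗-Reasoning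
  y = qpow k
  z = qpow (suc k)
  q-*1 : ∀ k → qpow (k ℕ.* 1) ≗ qpow k
  q-*1 k n = cong (λ e → qpow e n) (ℕₚ.*-identityʳ k)
W-shift k (suc M) = begin
  (one ⊕ z) ⊛ W (suc k) (suc M)
    ≈⟨ ⊛-congˡ (one ⊕ z) (⊕-cong (≗-refl {(one ⊖ x) ⊛ W′}) (⊛-cong b≗xa (poch₊-suc M))) ⟩
  (one ⊕ z) ⊛ (((one ⊖ x) ⊛ W′) ⊕ ((x ⊛ a) ⊛ (D ⊛ (one ⊕ x))))
    ≈⟨ solve 5 (λ x z a D W′ → (𝟙 :+ z) :* ((𝟙 :- x) :* W′ :+ x :* a :* (D :* (𝟙 :+ x)))
                            := (𝟙 :- x) :* ((𝟙 :+ z) :* W′) :+ (𝟙 :+ z) :* (x :* a :* (D :* (𝟙 :+ x))))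
                ≗-refl x z a D W′ ⟩
  ((one ⊖ x) ⊛ ((one ⊕ z) ⊛ W′)) ⊕ ((one ⊕ z) ⊛ ((x ⊛ a) ⊛ (D ⊛ (one ⊕ x))))
    ≈⟨ ⊕-cong (⊛-congˡ (one ⊖ x) IH) (≗-refl {(one ⊕ z) ⊛ ((x ⊛ a) ⊛ (D ⊛ (one ⊕ x)))}) ⟩
  ((one ⊖ x) ⊛ (((one ⊖ y) ⊛ W₀) ⊕ ((a ⊕ (x ⊛ a)) ⊛ D))) ⊕ ((one ⊕ z) ⊛ ((x ⊛ a) ⊛ (D ⊛ (one ⊕ x))))
    ≈⟨ solve 6 (λ x y z a D W₀ →
         (𝟙 :- x) :* ((𝟙 :- y) :* W₀ :+ (a :+ x :* a) :* D) :+ (𝟙 :+ z) :* (x :* a :* (D :* (𝟙 :+ x)))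
           := (𝟙 :- y) :* ((𝟙 :- x) :* W₀ :+ a :* (D :* (𝟙 :+ x))) :+ (y :* a :+ z :* (x :* a)) :* (D :* (𝟙 :+ x)))
         ≗-refl x y z a D W₀ ⟩
  ((one ⊖ y) ⊛ (((one ⊖ x) ⊛ W₀) ⊕ (a ⊛ (D ⊛ (one ⊕ x)))))
    ⊕ (((y ⊛ a) ⊕ (z ⊛ (x ⊛ a))) ⊛ (D ⊛ (one ⊕ x)))
    ≈⟨ ⊕-cong (⊛-congˡ (one ⊖ y) (⊕-cong (≗-refl {(one ⊖ x) ⊛ W₀}) (⊛-congˡ a (poch₊-suc M))))
              (⊛-cong (⊕-cong (qpow-*-suc k (suc M)) (≗-trans (qpow-*-suc (suc k) (suc M)) (⊛-congˡ z b≗xa)))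
                      (poch₊-suc M)) ⟨
  ((one ⊖ y) ⊛ W k (suc M)) ⊕ ((qpow (k ℕ.* suc (suc M)) ⊕ qpow (suc k ℕ.* suc (suc M))) ⊛ poch₊ (suc M)) ∎
  where
  open ≗-Reasoning
  x = qpow (suc M)
  y = qpow k
  z = qpow (suc k)
  a = qpow (k ℕ.* suc M)
  b = qpow (suc k ℕ.* suc M)
  D = poch₊ M
  W′ = W (suc k) M
  W₀ = W k M
  b≗xa : b ≗ (x ⊛ a)
  b≗xa = qpow-+ (suc M) (k ℕ.* suc M)
  IH : ((one ⊕ z) ⊛ W′) ≗ (((one ⊖ y) ⊛ W₀) ⊕ ((a ⊕ (x ⊛ a)) ⊛ D))
  IH = ≗-trans (W-shift k M) (⊕-cong (≗-refl {(one ⊖ y) ⊛ W₀}) (⊛-congʳ D (⊕-cong (≗-refl {a}) b≗xa)))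

W-closed : ∀ k M → (W (suc k) M ⊛ poch₊ (suc k)) ≈[ M ] (poch₋ k ⊛ poch₊ M)
W-closed zero M = begin
  W 1 M ⊛ poch₊ 1
    ≈⟨ ≗⇒≈ (≗-trans (⊛-congˡ (W 1 M) (poch₊-suc 0))
                     (solve 2 (λ w q → w :* (𝟙 :* (𝟙 :+ q)) := (𝟙 :+ q) :* w) ≗-refl (W 1 M) (qpow 1))) ⟩
  (one ⊕ qpow 1) ⊛ W 1 M
    ≈⟨ ≗⇒≈ (W-shift 0 M) ⟩
  ((one ⊖ one) ⊛ W 0 M) ⊕ ((one ⊕ qpow (1 ℕ.* suc M)) ⊛ D)
    ≈⟨ ⊕-congˡ-≈ ((one ⊖ one) ⊛ W 0 M) (⊛-congʳ-≈ D (⊕-congˡ-≈ one (qpow-≈0 (ℕₚ.m≤m+n (suc M) 0)))) ⟩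
  ((one ⊖ one) ⊛ W 0 M) ⊕ ((one ⊕ zeroPS) ⊛ D)
    ≈⟨ ≗⇒≈ (solve 2 (λ w D → (𝟙 :- 𝟙) :* w :+ (𝟙 :+ con (+ 0)) :* D := 𝟙 :* D) ≗-refl (W 0 M) D) ⟩
  one ⊛ D ∎
  where
  open ≈-Reasoning M
  D = poch₊ M
W-closed (suc k) M = begin
  W (suc j) M ⊛ poch₊ (suc j)
    ≈⟨ ≗⇒≈ (≗-trans (⊛-congˡ (W (suc j) M) (poch₊-suc j))
                     (solve 3 (λ w K z → w :* (K :* (𝟙 :+ z)) := (𝟙 :+ z) :* w :* K)
                            ≗-refl (W (suc j) M) K (qpow (suc j)))) ⟩
  ((one ⊕ qpow (suc j)) ⊛ W (suc j) M) ⊛ K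
    ≈⟨ ≗⇒≈ (⊛-congʳ K (W-shift j M)) ⟩
  (((one ⊖ y) ⊛ W j M) ⊕ ((qpow (j ℕ.* suc M) ⊕ qpow (suc j ℕ.* suc M)) ⊛ D)) ⊛ K
    ≈⟨ ⊛-congʳ-≈ K (⊕-congˡ-≈ ((one ⊖ y) ⊛ W j M)
                              (⊛-congʳ-≈ D (⊕-cong-≈ (qpow-≈0 (high k)) (qpow-≈0 (high j))))) ⟩
  (((one ⊖ y) ⊛ W j M) ⊕ ((zeroPS ⊕ zeroPS) ⊛ D)) ⊛ K
    ≈⟨ ≗⇒≈ (solve 4 (λ y w D K → ((𝟙 :- y) :* w :+ (con (+ 0) :+ con (+ 0)) :* D) :* K := (𝟙 :- y) :* (w :* K))
                    ≗-refl y (W j M) D K) ⟩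
  (one ⊖ y) ⊛ (W j M ⊛ K)
    ≈⟨ ⊛-congˡ-≈ (one ⊖ y) (W-closed k M) ⟩
  (one ⊖ y) ⊛ (poch₋ k ⊛ D)
    ≈⟨ ≗⇒≈ (≗-trans (solve 3 (λ y E D → (𝟙 :- y) :* (E :* D) := E :* (𝟙 :- y) :* D) ≗-refl y (poch₋ k) D)
                     (⊛-congʳ D (≗-sym (poch₋-suc k)))) ⟩
  poch₋ j ⊛ D ∎
  where
  open ≈-Reasoning M
  j = suc k
  y = qpow j
  D = poch₊ M
  K = poch₊ j
  high : ∀ i → M < suc i ℕ.* suc M
  high i = ℕₚ.m≤m+n (suc M) (i ℕ.* suc M)

sptBounded-W : ∀ k M → ((sptBounded (suc k) M ⊛ poch₊ M) ⊕ poch₋ M) ≗ W (suc k) M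
sptBounded-W k zero = begin
  (sptBounded (suc k) 0 ⊛ one) ⊕ one   ≈⟨ ⊕-cong (⊛-congʳ one (sptBounded-zero (suc k))) (≗-refl {one}) ⟩
  (zeroPS ⊛ one) ⊕ one                 ≈⟨ solve 0 (con (+ 0) :* 𝟙 :+ 𝟙 := 𝟙) ≗-refl ⟩
  one                                  ∎
  where open ≗-Reasoning
sptBounded-W k (suc M) = begin
  (Y ⊛ poch₊ (suc M)) ⊕ poch₋ (suc M)
    ≈⟨ ⊕-cong (⊛-congˡ Y (poch₊-suc M)) (poch₋-suc M) ⟩
  (Y ⊛ (D ⊛ (one ⊕ x))) ⊕ (E ⊛ (one ⊖ x))
    ≈⟨ solve 4 (λ x Y D E → Y :* (D :* (𝟙 :+ x)) :+ E :* (𝟙 :- x) := (𝟙 :+ x) :* Y :* D :+ E :* (𝟙 :- x))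
               ≗-refl x Y D E ⟩
  (((one ⊕ x) ⊛ Y) ⊛ D) ⊕ (E ⊛ (one ⊖ x))
    ≈⟨ ⊕-cong (⊛-congʳ D (sptBounded-recurrence k M)) (≗-refl {E ⊛ (one ⊖ x)}) ⟩
  ((((one ⊖ x) ⊛ X) ⊕ ((one ⊕ x) ⊛ Q)) ⊛ D) ⊕ (E ⊛ (one ⊖ x))
    ≈⟨ solve 5 (λ x D E X Q → ((𝟙 :- x) :* X :+ (𝟙 :+ x) :* Q) :* D :+ E :* (𝟙 :- x)
                            := (𝟙 :- x) :* (X :* D :+ E) :+ Q :* (D :* (𝟙 :+ x))) ≗-refl x D E X Q ⟩
  ((one ⊖ x) ⊛ ((X ⊛ D) ⊕ E)) ⊕ (Q ⊛ (D ⊛ (one ⊕ x)))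
    ≈⟨ ⊕-cong (⊛-congˡ (one ⊖ x) (sptBounded-W k M)) (⊛-congˡ Q (≗-sym (poch₊-suc M))) ⟩
  ((one ⊖ x) ⊛ W (suc k) M) ⊕ (Q ⊛ poch₊ (suc M)) ∎
  where
  open ≗-Reasoning
  x = qpow (suc M)
  Y = sptBounded (suc k) (suc M)
  X = sptBounded (suc k) M
  D = poch₊ M
  E = poch₋ M
  Q = qpow (suc k ℕ.* suc M)

sptBounded-closed : ∀ k M → sptBounded (suc k) M ≈[ M ] ((poch₋ k ⊘ poch₊ (suc k)) ⊖ (poch₋ M ⊘ poch₊ M))
sptBounded-closed k M = ⊛-cancelʳ-≈ {g = D ⊛ K} (cong₂ _*_ (poch₊-constant M) (poch₊-constant (suc k))) (begin
  T ⊛ (D ⊛ K)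
    ≈⟨ ≗⇒≈ (solve 4 (λ T D K E → T :* (D :* K) := (T :* D :+ E) :* K :- E :* K) ≗-refl T D K E) ⟩
  (((T ⊛ D) ⊕ E) ⊛ K) ⊖ (E ⊛ K)
    ≈⟨ ≗⇒≈ (⊖-cong (⊛-congʳ K (sptBounded-W k M)) (≗-refl {E ⊛ K})) ⟩
  (W (suc k) M ⊛ K) ⊖ (E ⊛ K)
    ≈⟨ ⊖-cong-≈ (W-closed k M) (λ _ _ → refl) ⟩
  (Eₖ ⊛ D) ⊖ (E ⊛ K)
    ≈⟨ ≗⇒≈ (solve 2 (λ a b → a :* 𝟙 :- b :* 𝟙 := a :- b) ≗-refl (Eₖ ⊛ D) (E ⊛ K)) ⟨
  ((Eₖ ⊛ D) ⊛ one) ⊖ ((E ⊛ K) ⊛ one)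
    ≈⟨ ≗⇒≈ (⊖-cong (⊛-congˡ (Eₖ ⊛ D) (inv-inverseʳ K (poch₊-constant (suc k))))
                    (⊛-congˡ (E ⊛ K) (inv-inverseʳ D (poch₊-constant M)))) ⟨
  ((Eₖ ⊛ D) ⊛ (K ⊛ inv K)) ⊖ ((E ⊛ K) ⊛ (D ⊛ inv D))
    ≈⟨ ≗⇒≈ (solve 6 (λ Eₖ E D K iD iK → (Eₖ :* iK :- E :* iD) :* (D :* K)
                                       := Eₖ :* D :* (K :* iK) :- E :* K :* (D :* iD))
                    ≗-refl Eₖ E D K (inv D) (inv K)) ⟨
  ((Eₖ ⊘ K) ⊖ (E ⊘ D)) ⊛ (D ⊛ K) ∎)
  where
  open ≈-Reasoning M
  T = sptBounded (suc k) M
  D = poch₊ M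
  K = poch₊ (suc k)
  E = poch₋ M
  Eₖ = poch₋ k
  poch₊-constant : ∀ N → poch₊ N 0 ≡ + 1
  poch₊-constant = poch-constant (neg (qpow 1)) refl

theorem2p3 : (k : ℕ) → 0 < k → (n : ℕ) →
    sptSeries k n
      ≡ ((poch (qpow 1) (k ∸ 1) ⊘ poch (neg (qpow 1)) k)
          ⊖ (pochInf (qpow 1) ⊘ pochInf (neg (qpow 1)))) n
theorem2p3 zero    ()
theorem2p3 (suc k) _  n = begin
  sptSeries (suc k) n
    ≡⟨ sptSeries≡sptBounded (suc k) n ⟩
  sptBounded (suc k) n n
    ≡⟨ sptBounded-closed k n n ℕₚ.≤-refl ⟩
  ((poch₋ k ⊘ poch₊ (suc k)) ⊖ (poch₋ n ⊘ poch₊ n)) n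
    ≡⟨ cong (_-_ ((poch₋ k ⊘ poch₊ (suc k)) n)) (pochInf-quotient-≈ n n ℕₚ.≤-refl) ⟨
  ((poch₋ k ⊘ poch₊ (suc k)) ⊖ (pochInf (qpow 1) ⊘ pochInf (neg (qpow 1)))) n ∎
  where open ≡-Reasoning
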